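{- Let $m$ be a positive integer and let $\Phi\subseteq\mathbf{2}^{[m]}$ be a face system with $\#\Phi>0$. Let $\Phi=[A_1,B_1]\,\dot\cup\cdots\dot\cup\,[A_\theta,B_\theta]$ be a partition of $\Phi$ into Boolean intervals, with profile $(\mathsf{p}_{ij})$. Then for every $0\le l\le m$: $h_l(\Phi;m)=(-1)^l\sum_{i,j}\mathsf{p}_{ij}(-1)^j\binom{m-i-j}{l-j}$; $\kappa_l(\mathbf{h}(\Phi;m),\mathbf{H}^{\bullet}_m)=\sum_{i,j}\mathsf{p}_{ij}\binom{i}{l-j}$; $\kappa_l(\mathbf{h}(\Phi;m),\mathbf{F}^{\blacktriangle}_m)=(-1)^l\sum_s\binom{s}{l}\sum_{i,j}\mathsf{p}_{ij}(-1)^j\binom{m-i-j}{s-j}$; $\kappa_l(\mathbf{h}(\Phi;m),\mathbf{H}^{\blacktriangle}_m)=(-1)^l\sum_{i,j}\mathsf{p}_{ij}(-1)^{i+j}\binom{j}{l-i}$; $\kappa_l(\mathbf{h}(\Phi;m),\mathbf{F}^{\blacktriangledown}_m)=(-1)^{m-l}\sum_s\binom{m-s}{l}\sum_{i,j}\mathsf{p}_{ij}(-1)^j\binom{m-i-j}{s-j}$; $\kappa_l(\mathbf{h}(\Phi;m),\mathbf{H}^{\blacktriangledown}_m)=(-1)^{m-l}\sum_{i,j}\mathsf{p}_{ij}(-1)^j\binom{m-i-j}{l-i}$.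
   Context: $[m]=\{1,\dots,m\}$; a face system is any $\Phi\subseteq\mathbf{2}^{[m]}$ (family of subsets of $[m]$), and $\#$ denotes the number of sets in a family. For faces $A\subseteq C\subseteq[m]$ the Boolean interval is $[A,C]=\{B\subseteq[m]:A\subseteq B\subseteq C\}$. For a partition of $\Phi$ into disjoint Boolean intervals $[A_k,B_k]$, $1\le k\le\theta$, its profile is given by $\mathsf{p}_{ij}=\#\{k:|B_k-A_k|=i,\ |A_k|=j\}$ (sums over $i,j$ run over all nonnegative integers, with $\mathsf{p}_{ij}=0$ if no such interval exists; sums over $s$ run over $0,\dots,m$). Binomial coefficients $\binom{a}{b}$ with $a\ge0$ are $0$ when $b<0$ or $b>a$. All vectors are row vectors in $\mathbb{R}^{m+1}$ with components indexed $0,\dots,m$. $f_i(\Phi;m)=\#\{F\in\Phi:|F|=i\}$, and $\mathbf{h}(\Phi;m)=(h_0(\Phi;m),\dots,h_m(\Phi;m))$ is defined by $\sum_{i=0}^m h_i(\Phi;m)y^{m-i}=\sum_{i=0}^m f_i(\Phi;m)(y-1)^{m-i}$. Bases of $\mathbb{R}^{m+1}$, each consisting of vectors indexed by $i=0,\dots,m$, with $j$th component given: $\mathbf{H}^{\bullet}_m$: $(-1)^{j-i}\binom{m-i}{j-i}$; $\mathbf{F}^{\blacktriangle}_m$: $\binom{i}{j}$; $\mathbf{H}^{\blacktriangle}_m$: $(-1)^j\binom{m-i}{j}$; $\mathbf{F}^{\blacktriangledown}_m$: $\binom{i}{m-j}$; $\mathbf{H}^{\blacktriangledown}_m$: $\delta_{m-i,j}$.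 For a basis $\mathfrak{B}=(b_0,\dots,b_m)$ and $w\in\mathbb{R}^{m+1}$, $\kappa_0(w,\mathfrak{B}),\dots,\kappa_m(w,\mathfrak{B})$ are the unique reals with $\sum_i\kappa_i(w,\mathfrak{B})b_i=w$. -}

module Defs where

open import Data.Nat as ℕ using (ℕ; zero; suc; _≤_; _≤?_; _∸_; _≟_)
open import Data.Nat.Combinatorics using (_C_)
open import Data.Integer as ℤ using (ℤ; +_; -[1+_]; -1ℤ; _^_)
open import Data.Fin.Subset using (Subset; _⊆_; _─_; ∣_∣)
open import Data.Fin.Subset.Properties using (_⊆?_)
open import Data.List using (List; length; filter)
open import Data.List.Membership.Propositional using (_∈_; _∉_)
open import Data.List.Relation.Unary.All using (All)
open import Data.Product using (_×_; _,_; proj₁; proj₂)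
open import Relation.Nullary.Decidable using (_×-dec_; yes; no)
open import Relation.Binary.PropositionalEquality using (_≡_)

sumTo : ℕ → (ℕ → ℤ) → ℤ
sumTo zero    f = f 0
sumTo (suc n) f = sumTo n f ℤ.+ f (suc n)

-- (-1)^e for an integer exponent e (sign depends only on parity)
sgn : ℤ → ℤ
sgn e = -1ℤ ^ ℤ.∣ e ∣

-- binomial coefficient (a choose b) with a ≥ 0 and b an integer; 0 if b < 0 (and if b > a)
binom : ℕ → ℤ → ℤ
binom a (+ b)    = + (a C b)
binom a -[1+ _ ] = + 0

-- a face system Φ ⊆ 2^[m]: a duplicate-free list of subsets of [m] (Unique assumed in the statement)
FaceSystem : ℕ → Set
FaceSystem m = List (Subset m)

fvec : ∀ {m} → FaceSystem m → ℕ → ℤ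
fvec Φ i = + length (filter (λ F → ∣ F ∣ ≟ i) Φ)

Intervals : ℕ → Set
Intervals m = List (Subset m × Subset m)

countContaining : ∀ {m} → Intervals m → Subset m → ℕ
countContaining Is F =
  length (filter (λ I → (proj₁ I ⊆? F) ×-dec (F ⊆? proj₂ I)) Is)

IsIntervalPartition : ∀ {m} → FaceSystem m → Intervals m → Set
IsIntervalPartition {m} Φ Is =
  All (λ I → proj₁ I ⊆ proj₂ I) Is ×
  ((F : Subset m) → (F ∈ Φ → countContaining Is F ≡ 1)
                  × (F ∉ Φ → countContaining Is F ≡ 0))

profile : ∀ {m} → Intervals m → ℕ → ℕ → ℤ
profile Is i j =
  + length (filter (λ I → (∣ proj₂ I ─ proj₁ I ∣ ≟ i) ×-dec (∣ proj₁ I ∣ ≟ j)) Is)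

-- h-vector defining identity:  Σ h_i y^{m-i} = Σ f_i (y-1)^{m-i}  (as polynomials in y;
-- stated for all integers y, which is equivalent since ℤ is an infinite domain)
IsHVector : ∀ {m} → FaceSystem m → (ℕ → ℤ) → Set
IsHVector {m} Φ h =
  (y : ℤ) → sumTo m (λ i → h i ℤ.* (y ^ (m ∸ i)))
          ≡ sumTo m (λ i → fvec Φ i ℤ.* ((y ℤ.- + 1) ^ (m ∸ i)))

-- bases of ℝ^{m+1}: b m i j = j-th component of the i-th basis vector
Hbul : ℕ → ℕ → ℕ → ℤ
Hbul m i j = sgn (+ j ℤ.- + i) ℤ.* binom (m ∸ i) (+ j ℤ.- + i)

Fup : ℕ → ℕ → ℕ → ℤ
Fup m i j = binom i (+ j)

Hup : ℕ → ℕ → ℕ → ℤ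
Hup m i j = sgn (+ j) ℤ.* binom (m ∸ i) (+ j)

Fdown : ℕ → ℕ → ℕ → ℤ
Fdown m i j = binom i (+ (m ∸ j))

Hdown : ℕ → ℕ → ℕ → ℤ
Hdown m i j with (m ∸ i) ≟ j
... | yes _ = + 1
... | no  _ = + 0

-- Since b is a basis, κ_l(w,b) is the unique such vector, so "κ_l(w,b) = c_l for all l"
-- is equivalent to IsCoords m b c w.
IsCoords : (m : ℕ) → (ℕ → ℕ → ℤ) → (ℕ → ℤ) → (ℕ → ℤ) → Set
IsCoords m b κ w = (j : ℕ) → j ≤ m → sumTo m (λ i → κ i ℤ.* b i j) ≡ w j

-- Σ_{i,j} p_ij g(i,j), with i,j ranging over 0..m (p_ij = 0 outside, since |B_k| ≤ m)
sumP : ∀ {m} → Intervals m → (ℕ → ℕ → ℤ) → ℤ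
sumP {m} Is g = sumTo m (λ i → sumTo m (λ j → profile Is i j ℤ.* g i j))

innerS : ∀ {m} → Intervals m → ℕ → ℤ
innerS {m} Is s = sumP Is (λ i j → sgn (+ j) ℤ.* binom (m ∸ i ∸ j) (+ s ℤ.- + j))

{-# OPTIONS --safe #-}
-- Each interval [A,B] of the partition contributes
--   Σ_{A ⊆ F ⊆ B} (y-1)^(m-|F|) = y^|B-A| (y-1)^(m-|B|)
-- to Σ_i f_i (y-1)^(m-i), so Σ_l h_l y^(m-l) = Σ_k y^i_k (y-1)^(m-i_k-j_k) with i_k = |B_k - A_k|,
-- j_k = |A_k|.  Pairing coordinates with the polynomials Σ_j b_ij y^(m-j) of the basis vectors
-- ((y-1)^(m-i), y^(m-i) (1+y)^i, y^i (y-1)^(m-i), (y+1)^i and y^i for the five bases) turns every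
-- formula, interval by interval, into an instance of the binomial theorem; for the two F-bases one
-- instead inverts the binomial transform and uses the formula for h.  Coefficients of integer
-- polynomials are compared by evaluating at an integer larger than all of them.

module Submission where

open import Defs
open import Data.Nat using (ℕ; zero; suc; _≤_; _<_; _∸_; z≤n; s≤s; _≤′_; ≤′-reflexive; ≤′-step)
import Data.Nat as ℕ
import Data.Nat.Properties as ℕP
open import Data.Nat.Combinatorics using (_C_; k>n⇒nCk≡0)
import Data.Nat.Tactic.RingSolver as ℕSolver
open import Data.Integer as ℤ using (ℤ; +_; -1ℤ; 0ℤ; 1ℤ; _+_; _*_; _-_; -_; _^_)
import Data.Integer.Properties as ℤP
open import Data.Integer.Tactic.RingSolver using (solve-∀)
open import Algebra.Properties.CommutativeSemigroup ℤP.+-commutativeSemigroup using (interchange)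
open import Algebra.Properties.CommutativeSemigroup ℤP.*-commutativeSemigroup
  using (x∙yz≈y∙xz; x∙yz≈y∙zx; xy∙z≈y∙xz; xy∙z≈x∙zy; xy∙z≈xz∙y) renaming (interchange to *-interchange)
open import Algebra.Properties.AbelianGroup ℤP.+-0-abelianGroup using (inverseʳ-unique)
import Algebra.Properties.CommutativeSemiring.Binomial ℤP.+-*-commutativeSemiring as Binomial
open import Algebra.Properties.CommutativeSemiring.Exp ℤP.+-*-commutativeSemiring using () renaming (_^_ to _^′_)
open import Algebra.Properties.Monoid.Sum ℤP.+-0-monoid using (sum; sum-cong-≗)
open import Algebra.Definitions.RawMonoid ℤ.+-0-rawMonoid using () renaming (_×_ to _×ₘ_)
open import Data.Bool using (true; false; if_then_else_)
import Data.Bool.Properties as Boolₚ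
open import Data.Vec using ([]; _∷_; here)
import Data.Vec.Properties as Vecₚ
open import Data.Fin using (toℕ)
open import Data.Fin.Subset using (Subset; _⊆_; _─_; ∣_∣; ∁; outside; inside)
open import Data.Fin.Subset.Properties using (_⊆?_; drop-∷-⊆; ∣p∣≤n; ∣∁p∣≡n∸∣p∣)
open import Data.List using (List; []; _∷_; length; filter)
open import Data.List.Relation.Unary.All using (All; []; _∷_)
import Data.List.Relation.Unary.All as All
open import Data.List.Relation.Unary.Any using (here; there)
open import Data.List.Relation.Unary.AllPairs using ([]; _∷_)
open import Data.List.Relation.Unary.Unique.Propositional using (Unique)
open import Data.List.Membership.Propositional using (_∈_; _∉_)
open import Data.Product using (_×_; _,_; proj₁; proj₂; ∃-syntax)
open import Data.Sum using (inj₁; inj₂)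
open import Function using (_∘_)
open import Relation.Nullary using (Dec; yes; no; does; ¬_; contradiction)
open import Relation.Nullary.Decidable using (_×-dec_)
open import Relation.Binary using (DecidableEquality)
open import Relation.Binary.PropositionalEquality

-- Finite sums and the binomial theorem

sumTo-cong : ∀ n {f g : ℕ → ℤ} → (∀ i → i ≤ n → f i ≡ g i) → sumTo n f ≡ sumTo n g
sumTo-cong zero    f≗g = f≗g 0 z≤n
sumTo-cong (suc n) f≗g =
  cong₂ _+_ (sumTo-cong n (λ i i≤n → f≗g i (ℕP.m≤n⇒m≤1+n i≤n))) (f≗g (suc n) ℕP.≤-refl)

sumTo-zero : ∀ n {f : ℕ → ℤ} → (∀ i → i ≤ n → f i ≡ 0ℤ) → sumTo n f ≡ 0ℤ
sumTo-zero zero    f≗0 = f≗0 0 z≤n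
sumTo-zero (suc n) f≗0 =
  cong₂ _+_ (sumTo-zero n (λ i i≤n → f≗0 i (ℕP.m≤n⇒m≤1+n i≤n))) (f≗0 (suc n) ℕP.≤-refl)

sumTo-+ : ∀ n (f g : ℕ → ℤ) → sumTo n (λ i → f i + g i) ≡ sumTo n f + sumTo n g
sumTo-+ zero    f g = refl
sumTo-+ (suc n) f g =
  trans (cong (_+ (f (suc n) + g (suc n))) (sumTo-+ n f g)) (interchange (sumTo n f) (sumTo n g) (f (suc n)) (g (suc n)))

sumTo-*ˡ : ∀ n c (f : ℕ → ℤ) → sumTo n (λ i → c * f i) ≡ c * sumTo n f
sumTo-*ˡ zero    c f = refl
sumTo-*ˡ (suc n) c f =
  trans (cong (_+ c * f (suc n)) (sumTo-*ˡ n c f)) (sym (ℤP.*-distribˡ-+ c _ _))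

sumTo-*ʳ : ∀ n c (f : ℕ → ℤ) → sumTo n (λ i → f i * c) ≡ sumTo n f * c
sumTo-*ʳ n c f = begin
  sumTo n (λ i → f i * c) ≡⟨ sumTo-cong n (λ i _ → ℤP.*-comm (f i) c) ⟩
  sumTo n (λ i → c * f i) ≡⟨ sumTo-*ˡ n c f ⟩
  c * sumTo n f           ≡⟨ ℤP.*-comm c _ ⟩
  sumTo n f * c           ∎
  where open ≡-Reasoning

sumTo-comm : ∀ m n (f : ℕ → ℕ → ℤ) →
  sumTo m (λ i → sumTo n (f i)) ≡ sumTo n (λ j → sumTo m (λ i → f i j))
sumTo-comm zero    n f = refl
sumTo-comm (suc m) n f =
  trans (cong (_+ sumTo n (f (suc m))) (sumTo-comm m n f)) (sym (sumTo-+ n _ (f (suc m))))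

sumTo-head : ∀ n (f : ℕ → ℤ) → sumTo (suc n) f ≡ f 0 + sumTo n (λ i → f (suc i))
sumTo-head zero    f = refl
sumTo-head (suc n) f =
  trans (cong (_+ f (suc (suc n))) (sumTo-head n f)) (ℤP.+-assoc (f 0) _ _)

sumTo-reverse : ∀ n (f : ℕ → ℤ) → sumTo n f ≡ sumTo n (λ i → f (n ∸ i))
sumTo-reverse zero    f = refl
sumTo-reverse (suc n) f = begin
  sumTo n f + f (suc n)                       ≡⟨ cong (_+ f (suc n)) (sumTo-reverse n f) ⟩
  sumTo n (λ i → f (n ∸ i)) + f (suc n)       ≡⟨ ℤP.+-comm _ (f (suc n)) ⟩
  f (suc n) + sumTo n (λ i → f (n ∸ i))       ≡⟨ sym (sumTo-head n (λ i → f (suc n ∸ i))) ⟩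
  sumTo (suc n) (λ i → f (suc n ∸ i))         ∎
  where open ≡-Reasoning

sumTo-delta : ∀ n {f : ℕ → ℤ} k → k ≤ n → (∀ i → i ≤ n → i ≢ k → f i ≡ 0ℤ) → sumTo n f ≡ f k
sumTo-delta zero    .0 z≤n _ = refl
sumTo-delta (suc n) {f} k k≤1+n f≗0 with ℕP.m≤n⇒m<n∨m≡n k≤1+n
... | inj₁ k<1+n = begin
  sumTo n f + f (suc n)
    ≡⟨ cong₂ _+_ (sumTo-delta n k (ℕP.≤-pred k<1+n) (λ i i≤n → f≗0 i (ℕP.m≤n⇒m≤1+n i≤n)))
                 (f≗0 (suc n) ℕP.≤-refl (ℕP.>⇒≢ k<1+n)) ⟩
  f k + 0ℤ
    ≡⟨ ℤP.+-identityʳ (f k) ⟩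
  f k ∎
  where open ≡-Reasoning
... | inj₂ refl = begin
  sumTo n f + f (suc n)
    ≡⟨ cong (_+ f (suc n)) (sumTo-zero n (λ i i≤n → f≗0 i (ℕP.m≤n⇒m≤1+n i≤n) (ℕP.<⇒≢ (s≤s i≤n)))) ⟩
  0ℤ + f (suc n)
    ≡⟨ ℤP.+-identityˡ _ ⟩
  f (suc n) ∎
  where open ≡-Reasoning

sumTo-truncate : ∀ {n m} {f : ℕ → ℤ} → n ≤ m → (∀ i → n < i → f i ≡ 0ℤ) → sumTo m f ≡ sumTo n f
sumTo-truncate {n} {f = f} n≤m f≗0 = go (ℕP.≤⇒≤′ n≤m)
  where
  go : ∀ {m} → n ≤′ m → sumTo m f ≡ sumTo n f
  go (≤′-reflexive refl) = refl
  go (≤′-step n≤′m) =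
    trans (cong₂ _+_ (go n≤′m) (f≗0 _ (s≤s (ℕP.≤′⇒≤ n≤′m)))) (ℤP.+-identityʳ (sumTo n f))

sumTo-dropPrefix : ∀ a n {f : ℕ → ℤ} → (∀ i → i < a → f i ≡ 0ℤ) →
  sumTo (a ℕ.+ n) f ≡ sumTo n (λ t → f (a ℕ.+ t))
sumTo-dropPrefix zero    n f≗0 = refl
sumTo-dropPrefix (suc a) n {f} f≗0 = begin
  sumTo (suc (a ℕ.+ n)) f
    ≡⟨ sumTo-head (a ℕ.+ n) f ⟩
  f 0 + sumTo (a ℕ.+ n) (λ i → f (suc i))
    ≡⟨ cong₂ _+_ (f≗0 0 (s≤s z≤n)) (sumTo-dropPrefix a n (λ i i<a → f≗0 (suc i) (s≤s i<a))) ⟩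
  0ℤ + sumTo n (λ t → f (suc a ℕ.+ t))
    ≡⟨ ℤP.+-identityˡ _ ⟩
  sumTo n (λ t → f (suc a ℕ.+ t)) ∎
  where open ≡-Reasoning

sumTo≡sum : ∀ n (f : ℕ → ℤ) → sumTo n f ≡ sum {suc n} (λ k → f (toℕ k))
sumTo≡sum zero    f = sym (ℤP.+-identityʳ (f 0))
sumTo≡sum (suc n) f = trans (sumTo-head n f) (cong (_+_ (f 0)) (sumTo≡sum n (λ i → f (suc i))))

×ₘ≡* : ∀ n x → n ×ₘ x ≡ + n * x
×ₘ≡* zero    x = refl
×ₘ≡* (suc n) x = trans (cong (_+_ x) (×ₘ≡* n x)) (sym (ℤP.suc-* (+ n) x))

^′≡^ : ∀ x n → x ^′ n ≡ x ^ n
^′≡^ x zero    = refl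
^′≡^ x (suc n) = cong (x *_) (^′≡^ x n)

binomial : ∀ n x y → (x + y) ^ n ≡ sumTo n (λ k → + (n C k) * (x ^ k * y ^ (n ∸ k)))
binomial n x y = begin
  (x + y) ^ n   ≡⟨ sym (^′≡^ (x + y) n) ⟩
  (x + y) ^′ n  ≡⟨ Binomial.theorem n x y ⟩
  _             ≡⟨ sum-cong-≗ {suc n} (λ k → term (toℕ k)) ⟩
  _             ≡⟨ sym (sumTo≡sum n (λ k → + (n C k) * (x ^ k * y ^ (n ∸ k)))) ⟩
  sumTo n (λ k → + (n C k) * (x ^ k * y ^ (n ∸ k))) ∎
  where
  open ≡-Reasoning
  term : ∀ k → (n C k) ×ₘ (x ^′ k * y ^′ (n ∸ k)) ≡ + (n C k) * (x ^ k * y ^ (n ∸ k))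
  term k = trans (×ₘ≡* (n C k) _) (cong (+ (n C k) *_) (cong₂ _*_ (^′≡^ x k) (^′≡^ y (n ∸ k))))

-- Indicators and sums over lists and subsets

-- Defined via does, so that it reduces together with filter, _⊆?_ and equality of subsets.
𝟙 : ∀ {p} {P : Set p} → Dec P → ℤ
𝟙 d = if does d then 1ℤ else 0ℤ

𝟙-yes : ∀ {p} {P : Set p} → P → (d : Dec P) → 𝟙 d ≡ 1ℤ
𝟙-yes p (yes _) = refl
𝟙-yes p (no ¬p) = contradiction p ¬p

𝟙-no : ∀ {p} {P : Set p} → ¬ P → (d : Dec P) → 𝟙 d ≡ 0ℤ
𝟙-no ¬p (yes p) = contradiction p ¬p
𝟙-no ¬p (no _)  = refl

𝟙-×-dec : ∀ {p q} {P : Set p} {Q : Set q} (d : Dec P) (e : Dec Q) → 𝟙 (d ×-dec e) ≡ 𝟙 d * 𝟙 e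
𝟙-×-dec (yes _) (yes _) = refl
𝟙-×-dec (yes _) (no _)  = refl
𝟙-×-dec (no _)  _       = refl

sumTo-𝟙 : ∀ m k (g : ℕ → ℤ) → k ≤ m → sumTo m (λ i → 𝟙 (k ℕ.≟ i) * g i) ≡ g k
sumTo-𝟙 m k g k≤m = begin
  sumTo m (λ i → 𝟙 (k ℕ.≟ i) * g i)
    ≡⟨ sumTo-delta m k k≤m (λ i _ i≢k → cong (_* g i) (𝟙-no (i≢k ∘ sym) (k ℕ.≟ i))) ⟩
  𝟙 (k ℕ.≟ k) * g k                 ≡⟨ cong (_* g k) (𝟙-yes refl (k ℕ.≟ k)) ⟩
  1ℤ * g k                          ≡⟨ ℤP.*-identityˡ (g k) ⟩
  g k                               ∎
  where open ≡-Reasoning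

sumOver : ∀ {a} {A : Set a} → List A → (A → ℤ) → ℤ
sumOver []       f = 0ℤ
sumOver (x ∷ xs) f = f x + sumOver xs f

sumOver-cong-All : ∀ {a p} {A : Set a} {P : A → Set p} {xs : List A} {f g : A → ℤ} →
  All P xs → (∀ {x} → P x → f x ≡ g x) → sumOver xs f ≡ sumOver xs g
sumOver-cong-All []         f≗g = refl
sumOver-cong-All (px ∷ pxs) f≗g = cong₂ _+_ (f≗g px) (sumOver-cong-All pxs f≗g)

sumOver-cong : ∀ {a} {A : Set a} (xs : List A) {f g : A → ℤ} → (∀ x → f x ≡ g x) → sumOver xs f ≡ sumOver xs g
sumOver-cong []       f≗g = refl
sumOver-cong (x ∷ xs) f≗g = cong₂ _+_ (f≗g x) (sumOver-cong xs f≗g)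

sumOver-*ʳ : ∀ {a} {A : Set a} (xs : List A) c (f : A → ℤ) → sumOver xs (λ x → f x * c) ≡ sumOver xs f * c
sumOver-*ʳ []       c f = refl
sumOver-*ʳ (x ∷ xs) c f =
  trans (cong (_+_ (f x * c)) (sumOver-*ʳ xs c f)) (sym (ℤP.*-distribʳ-+ c (f x) (sumOver xs f)))

sumOver-sumTo : ∀ {a} {A : Set a} (xs : List A) n (f : A → ℕ → ℤ) →
  sumOver xs (λ x → sumTo n (f x)) ≡ sumTo n (λ i → sumOver xs (λ x → f x i))
sumOver-sumTo []       n f = sym (sumTo-zero n (λ _ _ → refl))
sumOver-sumTo (x ∷ xs) n f =
  trans (cong (_+_ (sumTo n (f x))) (sumOver-sumTo xs n f)) (sym (sumTo-+ n (f x) _))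

length-filter≡sumOver-𝟙 : ∀ {a p} {A : Set a} {P : A → Set p} (P? : ∀ x → Dec (P x)) xs →
  + length (filter P? xs) ≡ sumOver xs (λ x → 𝟙 (P? x))
length-filter≡sumOver-𝟙 P? []       = refl
length-filter≡sumOver-𝟙 P? (x ∷ xs) with does (P? x)
... | true  = cong (_+_ 1ℤ) (length-filter≡sumOver-𝟙 P? xs)
... | false = trans (length-filter≡sumOver-𝟙 P? xs) (sym (ℤP.+-identityˡ _))

module _ {a} {A : Set a} (_≟_ : DecidableEquality A) where

  sumOver-𝟙≡-∉ : ∀ {x xs} → x ∉ xs → sumOver xs (λ y → 𝟙 (x ≟ y)) ≡ 0ℤ
  sumOver-𝟙≡-∉ {xs = []}     x∉xs = refl
  sumOver-𝟙≡-∉ {xs = y ∷ xs} x∉xs =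
    cong₂ _+_ (𝟙-no (x∉xs ∘ here) (_ ≟ y)) (sumOver-𝟙≡-∉ (x∉xs ∘ there))

  sumOver-𝟙≡-∈ : ∀ {x xs} → Unique xs → x ∈ xs → sumOver xs (λ y → 𝟙 (x ≟ y)) ≡ 1ℤ
  sumOver-𝟙≡-∈ (x≢xs ∷ _) (here refl) =
    cong₂ _+_ (𝟙-yes refl (_ ≟ _)) (sumOver-𝟙≡-∉ (λ x∈xs → All.lookup x≢xs x∈xs refl))
  sumOver-𝟙≡-∈ {xs = y ∷ _} (y≢xs ∷ xs!) (there x∈xs) =
    cong₂ _+_ (𝟙-no (λ x≡y → All.lookup y≢xs x∈xs (sym x≡y)) (_ ≟ y)) (sumOver-𝟙≡-∈ xs! x∈xs)

sumSubsets : ∀ m → (Subset m → ℤ) → ℤ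
sumSubsets zero    f = f []
sumSubsets (suc m) f = sumSubsets m (λ F → f (outside ∷ F)) + sumSubsets m (λ F → f (inside ∷ F))

sumSubsets-zero : ∀ m {f : Subset m → ℤ} → (∀ F → f F ≡ 0ℤ) → sumSubsets m f ≡ 0ℤ
sumSubsets-zero zero    f≗0 = f≗0 []
sumSubsets-zero (suc m) f≗0 =
  cong₂ _+_ (sumSubsets-zero m (f≗0 ∘ (outside ∷_))) (sumSubsets-zero m (f≗0 ∘ (inside ∷_)))

sumSubsets-cong : ∀ m {f g : Subset m → ℤ} → (∀ F → f F ≡ g F) → sumSubsets m f ≡ sumSubsets m g
sumSubsets-cong zero    f≗g = f≗g []
sumSubsets-cong (suc m) f≗g =
  cong₂ _+_ (sumSubsets-cong m (f≗g ∘ (outside ∷_))) (sumSubsets-cong m (f≗g ∘ (inside ∷_)))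

sumSubsets-+ : ∀ m (f g : Subset m → ℤ) → sumSubsets m (λ F → f F + g F) ≡ sumSubsets m f + sumSubsets m g
sumSubsets-+ zero    f g = refl
sumSubsets-+ (suc m) f g = trans
  (cong₂ _+_ (sumSubsets-+ m (f ∘ (outside ∷_)) (g ∘ (outside ∷_)))
             (sumSubsets-+ m (f ∘ (inside ∷_)) (g ∘ (inside ∷_))))
  (interchange (sumSubsets m (f ∘ (outside ∷_))) (sumSubsets m (g ∘ (outside ∷_))) _ _)

sumSubsets-*ˡ : ∀ m c (f : Subset m → ℤ) → sumSubsets m (λ F → c * f F) ≡ c * sumSubsets m f
sumSubsets-*ˡ zero    c f = refl
sumSubsets-*ˡ (suc m) c f = trans
  (cong₂ _+_ (sumSubsets-*ˡ m c (f ∘ (outside ∷_))) (sumSubsets-*ˡ m c (f ∘ (inside ∷_))))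
  (sym (ℤP.*-distribˡ-+ c _ _))

sumSubsets-*-middle : ∀ m c (f g : Subset m → ℤ) {s} → sumSubsets m (λ F → f F * g F) ≡ s →
  sumSubsets m (λ F → f F * (c * g F)) ≡ c * s
sumSubsets-*-middle m c f g fg≡s = begin
  sumSubsets m (λ F → f F * (c * g F)) ≡⟨ sumSubsets-cong m (λ F → x∙yz≈y∙xz (f F) c (g F)) ⟩
  sumSubsets m (λ F → c * (f F * g F)) ≡⟨ sumSubsets-*ˡ m c (λ F → f F * g F) ⟩
  c * sumSubsets m (λ F → f F * g F)   ≡⟨ cong (c *_) fg≡s ⟩
  c * _                                ∎
  where open ≡-Reasoning

sumOver-sumSubsets : ∀ {a} {A : Set a} (xs : List A) m (f : A → Subset m → ℤ) →
  sumOver xs (λ x → sumSubsets m (f x)) ≡ sumSubsets m (λ F → sumOver xs (λ x → f x F))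
sumOver-sumSubsets []       m f = sym (sumSubsets-zero m (λ _ → refl))
sumOver-sumSubsets (x ∷ xs) m f =
  trans (cong (_+_ (sumSubsets m (f x))) (sumOver-sumSubsets xs m f)) (sym (sumSubsets-+ m (f x) _))

_≟ˢ_ : ∀ {m} → DecidableEquality (Subset m)
_≟ˢ_ = Vecₚ.≡-dec Boolₚ._≟_

sumSubsets-𝟙≡ : ∀ m (G : Subset m) (f : Subset m → ℤ) → sumSubsets m (λ F → 𝟙 (F ≟ˢ G) * f F) ≡ f G
sumSubsets-𝟙≡ zero    []            f = ℤP.*-identityˡ (f [])
sumSubsets-𝟙≡ (suc m) (outside ∷ G) f =
  trans (cong₂ _+_ (sumSubsets-𝟙≡ m G (f ∘ (outside ∷_))) (sumSubsets-zero m (λ _ → refl))) (ℤP.+-identityʳ _)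
sumSubsets-𝟙≡ (suc m) (inside ∷ G)  f =
  trans (cong₂ _+_ (sumSubsets-zero m (λ _ → refl)) (sumSubsets-𝟙≡ m G (f ∘ (inside ∷_)))) (ℤP.+-identityˡ _)

-- Interval partitions of face systems

_∈?[_,_] : ∀ {m} (F A B : Subset m) → Dec (A ⊆ F × F ⊆ B)
F ∈?[ A , B ] = (A ⊆? F) ×-dec (F ⊆? B)

inside⊈outside : ∀ {m} {p q : Subset m} → ¬ (inside ∷ p ⊆ outside ∷ q)
inside⊈outside p⊆q with p⊆q here
... | ()

-- Coordinatewise, a position outside B contributes a factor w, one in B ─ A a factor 1 + w,
-- and one in A a factor 1.
sumSubsets-interval : ∀ {m} {A B : Subset m} → A ⊆ B → ∀ w →
  sumSubsets m (λ F → 𝟙 (F ∈?[ A , B ]) * w ^ ∣ ∁ F ∣) ≡ (1ℤ + w) ^ ∣ B ─ A ∣ * w ^ ∣ ∁ B ∣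
sumSubsets-interval {zero}  {[]}          {[]}          _   w = refl
sumSubsets-interval {suc m} {outside ∷ A} {outside ∷ B} A⊆B w = begin
  sumSubsets m (λ F → 𝟙 (F ∈?[ A , B ]) * (w * w ^ ∣ ∁ F ∣)) + sumSubsets m excluded
    ≡⟨ cong₂ _+_ (sumSubsets-*-middle m w (λ F → 𝟙 (F ∈?[ A , B ])) (λ F → w ^ ∣ ∁ F ∣) IH)
                 (sumSubsets-zero m excluded≡0) ⟩
  w * ((1ℤ + w) ^ k * w ^ c) + 0ℤ
    ≡⟨ ℤP.+-identityʳ (w * ((1ℤ + w) ^ k * w ^ c)) ⟩
  w * ((1ℤ + w) ^ k * w ^ c)
    ≡⟨ x∙yz≈y∙xz w ((1ℤ + w) ^ k) (w ^ c) ⟩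
  (1ℤ + w) ^ k * (w * w ^ c) ∎
  where
  open ≡-Reasoning
  k = ∣ B ─ A ∣
  c = ∣ ∁ B ∣
  IH = sumSubsets-interval (drop-∷-⊆ A⊆B) w
  excluded : Subset m → ℤ
  excluded F = 𝟙 ((inside ∷ F) ∈?[ outside ∷ A , outside ∷ B ]) * w ^ ∣ ∁ F ∣
  excluded≡0 : ∀ F → excluded F ≡ 0ℤ
  excluded≡0 F =
    cong (_* w ^ ∣ ∁ F ∣) (𝟙-no (inside⊈outside ∘ proj₂) ((inside ∷ F) ∈?[ outside ∷ A , outside ∷ B ]))
sumSubsets-interval {suc m} {outside ∷ A} {inside ∷ B}  A⊆B w = begin
  sumSubsets m (λ F → 𝟙 (F ∈?[ A , B ]) * (w * w ^ ∣ ∁ F ∣))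
    + sumSubsets m (λ F → 𝟙 (F ∈?[ A , B ]) * w ^ ∣ ∁ F ∣)
    ≡⟨ cong₂ _+_ (sumSubsets-*-middle m w (λ F → 𝟙 (F ∈?[ A , B ])) (λ F → w ^ ∣ ∁ F ∣) IH) IH ⟩
  w * ((1ℤ + w) ^ k * w ^ c) + (1ℤ + w) ^ k * w ^ c
    ≡⟨ w*x+x≡[1+w]*x w ((1ℤ + w) ^ k) (w ^ c) ⟩
  (1ℤ + w) * (1ℤ + w) ^ k * w ^ c ∎
  where
  open ≡-Reasoning
  k = ∣ B ─ A ∣
  c = ∣ ∁ B ∣
  IH = sumSubsets-interval (drop-∷-⊆ A⊆B) w
  w*x+x≡[1+w]*x : ∀ w p q → w * (p * q) + p * q ≡ (1ℤ + w) * p * q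
  w*x+x≡[1+w]*x = solve-∀
sumSubsets-interval {suc m} {inside ∷ A}  {inside ∷ B}  A⊆B w =
  trans (cong₂ _+_ (sumSubsets-zero m (λ _ → refl)) (sumSubsets-interval (drop-∷-⊆ A⊆B) w))
        (ℤP.+-identityˡ ((1ℤ + w) ^ ∣ B ─ A ∣ * w ^ ∣ ∁ B ∣))
sumSubsets-interval {suc m} {inside ∷ A}  {outside ∷ B} A⊆B w = contradiction (λ {x} → A⊆B {x}) inside⊈outside

∣q─p∣+∣p∣≡∣q∣ : ∀ {m} {p q : Subset m} → p ⊆ q → ∣ q ─ p ∣ ℕ.+ ∣ p ∣ ≡ ∣ q ∣
∣q─p∣+∣p∣≡∣q∣ {p = []}          {[]}          _   = refl
∣q─p∣+∣p∣≡∣q∣ {p = outside ∷ p} {outside ∷ q} p⊆q = ∣q─p∣+∣p∣≡∣q∣ (drop-∷-⊆ p⊆q)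
∣q─p∣+∣p∣≡∣q∣ {p = outside ∷ p} {inside ∷ q}  p⊆q = cong suc (∣q─p∣+∣p∣≡∣q∣ (drop-∷-⊆ p⊆q))
∣q─p∣+∣p∣≡∣q∣ {p = inside ∷ p}  {inside ∷ q}  p⊆q =
  trans (ℕP.+-suc ∣ q ─ p ∣ ∣ p ∣) (cong suc (∣q─p∣+∣p∣≡∣q∣ (drop-∷-⊆ p⊆q)))
∣q─p∣+∣p∣≡∣q∣ {p = inside ∷ p}  {outside ∷ q} p⊆q = contradiction (λ {x} → p⊆q {x}) inside⊈outside

gap base : ∀ {m} → Subset m × Subset m → ℕ
gap  I = ∣ proj₂ I ─ proj₁ I ∣
base I = ∣ proj₁ I ∣

gap≤m : ∀ {m} (I : Subset m × Subset m) → gap I ≤ m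
gap≤m I = ∣p∣≤n (proj₂ I ─ proj₁ I)

gap+base≤m : ∀ {m} (I : Subset m × Subset m) → proj₁ I ⊆ proj₂ I → gap I ℕ.+ base I ≤ m
gap+base≤m I A⊆B = subst (_≤ _) (sym (∣q─p∣+∣p∣≡∣q∣ A⊆B)) (∣p∣≤n (proj₂ I))

sumTo-𝟙×𝟙 : ∀ m a b (g : ℕ → ℕ → ℤ) → a ≤ m → b ≤ m →
  sumTo m (λ i → sumTo m (λ j → 𝟙 ((a ℕ.≟ i) ×-dec (b ℕ.≟ j)) * g i j)) ≡ g a b
sumTo-𝟙×𝟙 m a b g a≤m b≤m = begin
  sumTo m (λ i → sumTo m (λ j → 𝟙 ((a ℕ.≟ i) ×-dec (b ℕ.≟ j)) * g i j))
    ≡⟨ sumTo-cong m (λ i _ → sumTo-cong m (λ j _ → split i j)) ⟩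
  sumTo m (λ i → sumTo m (λ j → 𝟙 (a ℕ.≟ i) * (𝟙 (b ℕ.≟ j) * g i j)))
    ≡⟨ sumTo-cong m (λ i _ →
         trans (sumTo-*ˡ m (𝟙 (a ℕ.≟ i)) _) (cong (𝟙 (a ℕ.≟ i) *_) (sumTo-𝟙 m b (g i) b≤m))) ⟩
  sumTo m (λ i → 𝟙 (a ℕ.≟ i) * g i b)
    ≡⟨ sumTo-𝟙 m a (λ i → g i b) a≤m ⟩
  g a b ∎
  where
  open ≡-Reasoning
  split : ∀ i j → 𝟙 ((a ℕ.≟ i) ×-dec (b ℕ.≟ j)) * g i j ≡ 𝟙 (a ℕ.≟ i) * (𝟙 (b ℕ.≟ j) * g i j)
  split i j =
    trans (cong (_* g i j) (𝟙-×-dec (a ℕ.≟ i) (b ℕ.≟ j))) (ℤP.*-assoc (𝟙 (a ℕ.≟ i)) (𝟙 (b ℕ.≟ j)) (g i j))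

sumP≡sumOver : ∀ {m} (Is : Intervals m) (g : ℕ → ℕ → ℤ) → sumP Is g ≡ sumOver Is (λ I → g (gap I) (base I))
sumP≡sumOver {m} Is g = begin
  sumTo m (λ i → sumTo m (λ j → profile Is i j * g i j))
    ≡⟨ sumTo-cong m (λ i _ → sumTo-cong m (λ j _ →
         trans (cong (_* g i j) (length-filter≡sumOver-𝟙 (D i j) Is)) (sym (sumOver-*ʳ Is (g i j) _)))) ⟩
  sumTo m (λ i → sumTo m (λ j → sumOver Is (λ I → 𝟙 (D i j I) * g i j)))
    ≡⟨ sumTo-cong m (λ i _ → sym (sumOver-sumTo Is m _)) ⟩
  sumTo m (λ i → sumOver Is (λ I → sumTo m (λ j → 𝟙 (D i j I) * g i j)))
    ≡⟨ sym (sumOver-sumTo Is m _) ⟩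
  sumOver Is (λ I → sumTo m (λ i → sumTo m (λ j → 𝟙 (D i j I) * g i j)))
    ≡⟨ sumOver-cong Is (λ I → sumTo-𝟙×𝟙 m (gap I) (base I) g (gap≤m I) (∣p∣≤n (proj₁ I))) ⟩
  sumOver Is (λ I → g (gap I) (base I)) ∎
  where
  open ≡-Reasoning
  D : ∀ i j (I : Subset m × Subset m) → Dec (gap I ≡ i × base I ≡ j)
  D i j I = (gap I ℕ.≟ i) ×-dec (base I ℕ.≟ j)

sumTo-fvec : ∀ {m} (Φ : FaceSystem m) (g : ℕ → ℤ) →
  sumTo m (λ i → fvec Φ i * g i) ≡ sumOver Φ (λ F → g ∣ F ∣)
sumTo-fvec {m} Φ g = begin
  sumTo m (λ i → fvec Φ i * g i)
    ≡⟨ sumTo-cong m (λ i _ →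
         trans (cong (_* g i) (length-filter≡sumOver-𝟙 (λ F → ∣ F ∣ ℕ.≟ i) Φ)) (sym (sumOver-*ʳ Φ (g i) _))) ⟩
  sumTo m (λ i → sumOver Φ (λ F → 𝟙 (∣ F ∣ ℕ.≟ i) * g i))
    ≡⟨ sym (sumOver-sumTo Φ m _) ⟩
  sumOver Φ (λ F → sumTo m (λ i → 𝟙 (∣ F ∣ ℕ.≟ i) * g i))
    ≡⟨ sumOver-cong Φ (λ F → sumTo-𝟙 m ∣ F ∣ g (∣p∣≤n F)) ⟩
  sumOver Φ (λ F → g ∣ F ∣) ∎
  where open ≡-Reasoning

multiplicity≡coverage : ∀ {m} {Φ : FaceSystem m} {Is : Intervals m} → Unique Φ → IsIntervalPartition Φ Is →
  ∀ F → sumOver Φ (λ G → 𝟙 (F ≟ˢ G)) ≡ sumOver Is (λ I → 𝟙 (F ∈?[ proj₁ I , proj₂ I ]))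
multiplicity≡coverage {Φ = Φ} {Is} Φ! (_ , covers) F =
  trans (by-membership (F ∈? Φ)) (length-filter≡sumOver-𝟙 _ Is)
  where
  open import Data.List.Membership.DecPropositional _≟ˢ_ using (_∈?_)
  by-membership : Dec (F ∈ Φ) → sumOver Φ (λ G → 𝟙 (F ≟ˢ G)) ≡ + countContaining Is F
  by-membership (yes F∈Φ) = trans (sumOver-𝟙≡-∈ _≟ˢ_ Φ! F∈Φ) (cong +_ (sym (proj₁ (covers F) F∈Φ)))
  by-membership (no  F∉Φ) = trans (sumOver-𝟙≡-∉ _≟ˢ_ F∉Φ) (cong +_ (sym (proj₂ (covers F) F∉Φ)))

sumOver-partition : ∀ {m} {Φ : FaceSystem m} {Is : Intervals m} → Unique Φ → IsIntervalPartition Φ Is →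
  ∀ (W : Subset m → ℤ) →
  sumOver Φ W ≡ sumOver Is (λ I → sumSubsets m (λ F → 𝟙 (F ∈?[ proj₁ I , proj₂ I ]) * W F))
sumOver-partition {m} {Φ} {Is} Φ! part W = begin
  sumOver Φ W
    ≡⟨ sumOver-cong Φ (λ G → sym (sumSubsets-𝟙≡ m G W)) ⟩
  sumOver Φ (λ G → sumSubsets m (λ F → 𝟙 (F ≟ˢ G) * W F))
    ≡⟨ sumOver-sumSubsets Φ m _ ⟩
  sumSubsets m (λ F → sumOver Φ (λ G → 𝟙 (F ≟ˢ G) * W F))
    ≡⟨ sumSubsets-cong m (λ F →
         trans (sumOver-*ʳ Φ (W F) _) (cong (_* W F) (multiplicity≡coverage Φ! part F))) ⟩
  sumSubsets m (λ F → sumOver Is (λ I → 𝟙 (F ∈?[ proj₁ I , proj₂ I ])) * W F)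
    ≡⟨ sumSubsets-cong m (λ F → sym (sumOver-*ʳ Is (W F) _)) ⟩
  sumSubsets m (λ F → sumOver Is (λ I → 𝟙 (F ∈?[ proj₁ I , proj₂ I ]) * W F))
    ≡⟨ sym (sumOver-sumSubsets Is m _) ⟩
  sumOver Is (λ I → sumSubsets m (λ F → 𝟙 (F ∈?[ proj₁ I , proj₂ I ]) * W F)) ∎
  where open ≡-Reasoning

-- The contribution of an interval with |B ─ A| = a and |A| = b to Σ_l h_l y^(m-l).
intervalPoly : ℕ → ℕ → ℕ → ℤ → ℤ
intervalPoly m a b y = y ^ a * (-1ℤ + y) ^ (m ∸ a ∸ b)

fPoly≡sumOver-intervalPoly : ∀ {m} {Φ : FaceSystem m} {Is : Intervals m} → Unique Φ → IsIntervalPartition Φ Is →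
  ∀ y → sumTo m (λ i → fvec Φ i * (y - 1ℤ) ^ (m ∸ i)) ≡ sumOver Is (λ I → intervalPoly m (gap I) (base I) y)
fPoly≡sumOver-intervalPoly {m} {Φ} {Is} Φ! part y = begin
  sumTo m (λ i → fvec Φ i * (y - 1ℤ) ^ (m ∸ i))
    ≡⟨ sumTo-fvec Φ (λ i → (y - 1ℤ) ^ (m ∸ i)) ⟩
  sumOver Φ (λ F → (y - 1ℤ) ^ (m ∸ ∣ F ∣))
    ≡⟨ cong (λ v → sumOver Φ (λ F → v ^ (m ∸ ∣ F ∣))) (ℤP.+-comm y -1ℤ) ⟩
  sumOver Φ (λ F → w ^ (m ∸ ∣ F ∣))
    ≡⟨ sumOver-cong Φ (λ F → cong (w ^_) (sym (∣∁p∣≡n∸∣p∣ F))) ⟩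
  sumOver Φ (λ F → w ^ ∣ ∁ F ∣)
    ≡⟨ sumOver-partition Φ! part (λ F → w ^ ∣ ∁ F ∣) ⟩
  sumOver Is (λ I → sumSubsets m (λ F → 𝟙 (F ∈?[ proj₁ I , proj₂ I ]) * w ^ ∣ ∁ F ∣))
    ≡⟨ sumOver-cong-All (proj₁ part) (λ {I} A⊆B → trans (sumSubsets-interval A⊆B w) (closed-form I A⊆B)) ⟩
  sumOver Is (λ I → intervalPoly m (gap I) (base I) y) ∎
  where
  open ≡-Reasoning
  w = -1ℤ + y
  closed-form : ∀ I → proj₁ I ⊆ proj₂ I →
    (1ℤ + w) ^ gap I * w ^ ∣ ∁ (proj₂ I) ∣ ≡ intervalPoly m (gap I) (base I) y
  closed-form I A⊆B = cong₂ _*_ (cong (_^ gap I) (ℤP.suc-pred y)) (cong (w ^_) (begin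
    ∣ ∁ (proj₂ I) ∣          ≡⟨ ∣∁p∣≡n∸∣p∣ (proj₂ I) ⟩
    m ∸ ∣ proj₂ I ∣          ≡⟨ cong (m ∸_) (sym (∣q─p∣+∣p∣≡∣q∣ A⊆B)) ⟩
    m ∸ (gap I ℕ.+ base I)   ≡⟨ sym (ℕP.∸-+-assoc m (gap I) (base I)) ⟩
    m ∸ gap I ∸ base I       ∎))

-- Coefficients of integer polynomials

poly : ℕ → (ℕ → ℤ) → ℤ → ℤ
poly m c y = sumTo m (λ j → c j * y ^ (m ∸ j))

poly-suc : ∀ m c y → poly (suc m) c y ≡ y * poly m c y + c (suc m)
poly-suc m c y = cong₂ _+_ shifted last
  where
  shifted : sumTo m (λ j → c j * y ^ (suc m ∸ j)) ≡ y * poly m c y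
  shifted = trans (sumTo-cong m (λ j j≤m →
                    trans (cong (λ k → c j * y ^ k) (ℕP.+-∸-assoc 1 j≤m)) (x∙yz≈y∙xz (c j) y _)))
                  (sumTo-*ˡ m y _)
  last : c (suc m) * y ^ (m ∸ m) ≡ c (suc m)
  last = trans (cong (λ k → c (suc m) * y ^ k) (ℕP.n∸n≡0 m)) (ℤP.*-identityʳ (c (suc m)))

sumTo-neg : ∀ n (f : ℕ → ℤ) → sumTo n (λ i → - f i) ≡ - sumTo n f
sumTo-neg zero    f = refl
sumTo-neg (suc n) f =
  trans (cong (_+ - f (suc n)) (sumTo-neg n f)) (sym (ℤP.neg-distrib-+ (sumTo n f) (f (suc n))))

poly-sub : ∀ m u v y → poly m (λ j → u j - v j) y ≡ poly m u y - poly m v y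
poly-sub m u v y = begin
  sumTo m (λ j → (u j - v j) * y ^ (m ∸ j))
    ≡⟨ sumTo-cong m (λ j _ → trans (ℤP.*-distribʳ-+ _ (u j) (- v j))
                                   (cong (_+_ (u j * y ^ (m ∸ j))) (sym (ℤP.neg-distribˡ-* (v j) _)))) ⟩
  sumTo m (λ j → u j * y ^ (m ∸ j) + - (v j * y ^ (m ∸ j)))
    ≡⟨ sumTo-+ m _ _ ⟩
  poly m u y + sumTo m (λ j → - (v j * y ^ (m ∸ j)))
    ≡⟨ cong (_+_ (poly m u y)) (sumTo-neg m _) ⟩
  poly m u y - poly m v y ∎
  where open ≡-Reasoning

B*X+r≡0⇒X≡0 : ∀ B X r → + B * X + r ≡ 0ℤ → ℤ.∣ r ∣ < B → X ≡ 0ℤ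
B*X+r≡0⇒X≡0 B X r BX+r≡0 ∣r∣<B = ℤP.∣i∣≡0⇒i≡0 (ℕP.n<1⇒n≡0 (ℕP.*-cancelˡ-< B _ _ B*∣X∣<B*1))
  where
  ∣r∣≡B*∣X∣ : ℤ.∣ r ∣ ≡ B ℕ.* ℤ.∣ X ∣
  ∣r∣≡B*∣X∣ = begin
    ℤ.∣ r ∣           ≡⟨ cong ℤ.∣_∣ (inverseʳ-unique (+ B * X) r BX+r≡0) ⟩
    ℤ.∣ - (+ B * X) ∣ ≡⟨ ℤP.∣-i∣≡∣i∣ (+ B * X) ⟩
    ℤ.∣ + B * X ∣     ≡⟨ ℤP.abs-* (+ B) X ⟩
    B ℕ.* ℤ.∣ X ∣     ∎
    where open ≡-Reasoning
  B*∣X∣<B*1 : B ℕ.* ℤ.∣ X ∣ < B ℕ.* 1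
  B*∣X∣<B*1 = subst₂ _<_ ∣r∣≡B*∣X∣ (sym (ℕP.*-identityʳ B)) ∣r∣<B

poly[B]≡0⇒coeffs≡0 : ∀ m c B → (∀ j → j ≤ m → ℤ.∣ c j ∣ < B) → poly m c (+ B) ≡ 0ℤ →
  ∀ j → j ≤ m → c j ≡ 0ℤ
poly[B]≡0⇒coeffs≡0 zero    c B _     p≡0 .0 z≤n = trans (sym (ℤP.*-identityʳ (c 0))) p≡0
poly[B]≡0⇒coeffs≡0 (suc m) c B ∣c∣<B p≡0 = coeffs≡0
  where
  Bp+c≡0 : + B * poly m c (+ B) + c (suc m) ≡ 0ℤ
  Bp+c≡0 = trans (sym (poly-suc m c (+ B))) p≡0
  lower≡0 : poly m c (+ B) ≡ 0ℤ
  lower≡0 = B*X+r≡0⇒X≡0 B _ (c (suc m)) Bp+c≡0 (∣c∣<B (suc m) ℕP.≤-refl)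
  top≡0 : c (suc m) ≡ 0ℤ
  top≡0 = begin
    c (suc m)                             ≡⟨ sym (ℤP.+-identityˡ (c (suc m))) ⟩
    0ℤ + c (suc m)                        ≡⟨ cong (_+ c (suc m)) (sym (ℤP.*-zeroʳ (+ B))) ⟩
    + B * 0ℤ + c (suc m)                  ≡⟨ cong (λ X → + B * X + c (suc m)) (sym lower≡0) ⟩
    + B * poly m c (+ B) + c (suc m)      ≡⟨ Bp+c≡0 ⟩
    0ℤ                                    ∎
    where open ≡-Reasoning
  coeffs≡0 : ∀ j → j ≤ suc m → c j ≡ 0ℤ
  coeffs≡0 j j≤1+m with ℕP.m≤n⇒m<n∨m≡n j≤1+m
  ... | inj₁ j<1+m =
    poly[B]≡0⇒coeffs≡0 m c B (λ i i≤m → ∣c∣<B i (ℕP.m≤n⇒m≤1+n i≤m)) lower≡0 j (ℕP.≤-pred j<1+m)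
  ... | inj₂ refl  = top≡0

upperBound : ∀ m (c : ℕ → ℕ) → ∃[ B ] (∀ j → j ≤ m → c j < B)
upperBound zero    c = suc (c 0) , λ { zero _ → ℕP.≤-refl }
upperBound (suc m) c with upperBound m c
... | B , c<B = B ℕ.⊔ suc (c (suc m)) , bounded
  where
  bounded : ∀ j → j ≤ suc m → c j < B ℕ.⊔ suc (c (suc m))
  bounded j j≤1+m with ℕP.m≤n⇒m<n∨m≡n j≤1+m
  ... | inj₁ j<1+m = ℕP.≤-trans (c<B j (ℕP.≤-pred j<1+m)) (ℕP.m≤m⊔n B _)
  ... | inj₂ refl  = ℕP.m≤n⊔m B _

-- At an integer B above every ∣ u j - v j ∣ the coefficients are read off like base-B digits.
poly-coeffs-unique : ∀ m (u v : ℕ → ℤ) → (∀ y → poly m u y ≡ poly m v y) → ∀ j → j ≤ m → u j ≡ v j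
poly-coeffs-unique m u v u≗v j j≤m with upperBound m (λ i → ℤ.∣ u i - v i ∣)
... | B , ∣u-v∣<B =
  ℤP.i-j≡0⇒i≡j (u j) (v j) (poly[B]≡0⇒coeffs≡0 m (λ i → u i - v i) B ∣u-v∣<B diff≡0 j j≤m)
  where
  diff≡0 : poly m (λ i → u i - v i) (+ B) ≡ 0ℤ
  diff≡0 = begin
    poly m (λ i → u i - v i) (+ B)    ≡⟨ poly-sub m u v (+ B) ⟩
    poly m u (+ B) - poly m v (+ B)   ≡⟨ cong (_- poly m v (+ B)) (u≗v (+ B)) ⟩
    poly m v (+ B) - poly m v (+ B)   ≡⟨ ℤP.+-inverseʳ (poly m v (+ B)) ⟩
    0ℤ                                ∎
    where open ≡-Reasoning

isCoords-fromPoly : ∀ m (b : ℕ → ℕ → ℤ) (κ w : ℕ → ℤ) (e : ℕ → ℤ → ℤ) →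
  (∀ i y → i ≤ m → poly m (b i) y ≡ e i y) →
  (∀ y → sumTo m (λ i → κ i * e i y) ≡ poly m w y) →
  IsCoords m b κ w
isCoords-fromPoly m b κ w e b≗e κe≡w = poly-coeffs-unique m (λ j → sumTo m (λ i → κ i * b i j)) w λ y → begin
  sumTo m (λ j → sumTo m (λ i → κ i * b i j) * y ^ (m ∸ j))
    ≡⟨ sumTo-cong m (λ j _ → sym (sumTo-*ʳ m (y ^ (m ∸ j)) _)) ⟩
  sumTo m (λ j → sumTo m (λ i → κ i * b i j * y ^ (m ∸ j)))
    ≡⟨ sumTo-comm m m _ ⟩
  sumTo m (λ i → sumTo m (λ j → κ i * b i j * y ^ (m ∸ j)))
    ≡⟨ sumTo-cong m (λ i i≤m → trans (sumTo-cong m (λ j _ → ℤP.*-assoc (κ i) (b i j) _))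
                                    (trans (sumTo-*ˡ m (κ i) _) (cong (κ i *_) (b≗e i y i≤m)))) ⟩
  sumTo m (λ i → κ i * e i y)
    ≡⟨ κe≡w y ⟩
  poly m w y ∎
  where open ≡-Reasoning

-- Binomial computations for the five bases

+[m+n]-+m≡+n : ∀ m n → + (m ℕ.+ n) - + m ≡ + n
+[m+n]-+m≡+n m n =
  trans (ℤP.[+m]-[+n]≡m⊖n (m ℕ.+ n) m) (trans (ℤP.⊖-≥ (ℕP.m≤m+n m n)) (cong +_ (ℕP.m+n∸m≡n m n)))

binom-shift : ∀ n a t → binom n (+ (a ℕ.+ t) - + a) ≡ + (n C t)
binom-shift n a t = cong (binom n) (+[m+n]-+m≡+n a t)

binom-below : ∀ n {a l} → l < a → binom n (+ l - + a) ≡ 0ℤ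
binom-below n {suc a} {l} (s≤s l≤a)
  rewrite ℤP.[+m]-[+n]≡m⊖n l (suc a) | ℤP.⊖-< (s≤s l≤a) | ℕP.+-∸-assoc 1 l≤a = refl

binom-above : ∀ n {a l} → a ℕ.+ n < l → binom n (+ l - + a) ≡ 0ℤ
binom-above n {a} {l} a+n<l = begin
  binom n (+ l - + a)                 ≡⟨ cong (λ k → binom n (+ k - + a)) (sym (ℕP.m+[n∸m]≡n a≤l)) ⟩
  binom n (+ (a ℕ.+ (l ∸ a)) - + a)   ≡⟨ binom-shift n a (l ∸ a) ⟩
  + (n C (l ∸ a))                     ≡⟨ cong +_ (k>n⇒nCk≡0 n<l∸a) ⟩
  0ℤ                                  ∎
  where
  open ≡-Reasoning
  a≤l : a ≤ l
  a≤l = ℕP.≤-trans (ℕP.m≤m+n a n) (ℕP.<⇒≤ a+n<l)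
  n<l∸a : n < l ∸ a
  n<l∸a = subst (_≤ l ∸ a) (ℕP.m+n∸m≡n a (suc n))
                (ℕP.∸-monoˡ-≤ a (subst (_≤ l) (sym (ℕP.+-suc a n)) a+n<l))

sumTo-binom-shift : ∀ m n a (g : ℕ → ℤ) → a ℕ.+ n ≤ m →
  sumTo m (λ l → binom n (+ l - + a) * g l) ≡ sumTo n (λ t → + (n C t) * g (a ℕ.+ t))
sumTo-binom-shift m n a g a+n≤m = begin
  sumTo m (λ l → binom n (+ l - + a) * g l)
    ≡⟨ sumTo-truncate a+n≤m (λ l a+n<l → cong (_* g l) (binom-above n a+n<l)) ⟩
  sumTo (a ℕ.+ n) (λ l → binom n (+ l - + a) * g l)
    ≡⟨ sumTo-dropPrefix a n (λ l l<a → cong (_* g l) (binom-below n l<a)) ⟩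
  sumTo n (λ t → binom n (+ (a ℕ.+ t) - + a) * g (a ℕ.+ t))
    ≡⟨ sumTo-cong n (λ t _ → cong (_* g (a ℕ.+ t)) (binom-shift n a t)) ⟩
  sumTo n (λ t → + (n C t) * g (a ℕ.+ t)) ∎
  where open ≡-Reasoning

binomial-window : ∀ m n a x y c (g : ℕ → ℤ) → a ℕ.+ n ≤ m →
  (∀ t → t ≤ n → g (a ℕ.+ t) ≡ c * (x ^ t * y ^ (n ∸ t))) →
  sumTo m (λ l → binom n (+ l - + a) * g l) ≡ c * (x + y) ^ n
binomial-window m n a x y c g a+n≤m g≡ = begin
  sumTo m (λ l → binom n (+ l - + a) * g l)
    ≡⟨ sumTo-binom-shift m n a g a+n≤m ⟩
  sumTo n (λ t → + (n C t) * g (a ℕ.+ t))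
    ≡⟨ sumTo-cong n (λ t t≤n → trans (cong (+ (n C t) *_) (g≡ t t≤n)) (x∙yz≈y∙xz (+ (n C t)) c _)) ⟩
  sumTo n (λ t → c * (+ (n C t) * (x ^ t * y ^ (n ∸ t))))
    ≡⟨ sumTo-*ˡ n c _ ⟩
  c * sumTo n (λ t → + (n C t) * (x ^ t * y ^ (n ∸ t)))
    ≡⟨ cong (c *_) (sym (binomial n x y)) ⟩
  c * (x + y) ^ n ∎
  where open ≡-Reasoning

binomial-window₀ : ∀ m n x y c (g : ℕ → ℤ) → n ≤ m →
  (∀ t → t ≤ n → g t ≡ c * (x ^ t * y ^ (n ∸ t))) →
  sumTo m (λ l → binom n (+ l) * g l) ≡ c * (x + y) ^ n
binomial-window₀ m n x y c g n≤m g≡ =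
  trans (sumTo-cong m (λ l _ → cong (λ k → binom n k * g l) (sym (ℤP.+-identityʳ (+ l)))))
        (binomial-window m n 0 x y c g n≤m g≡)

sgn-+ : ∀ a b → sgn (+ (a ℕ.+ b)) ≡ sgn (+ a) * sgn (+ b)
sgn-+ = ℤP.^-distribˡ-+-* -1ℤ

sgn-cancel : ∀ a x → sgn (+ a) * (sgn (+ a) * x) ≡ x
sgn-cancel zero    x = trans (ℤP.*-identityˡ _) (ℤP.*-identityˡ x)
sgn-cancel (suc a) x = trans (flip-twice (sgn (+ a)) x) (sgn-cancel a x)
  where
  flip-twice : ∀ s x → -1ℤ * s * (-1ℤ * s * x) ≡ s * (s * x)
  flip-twice = solve-∀

1^n*x≡x : ∀ n x → 1ℤ ^ n * x ≡ x
1^n*x≡x n x = trans (cong (_* x) (ℤP.^-zeroˡ n)) (ℤP.*-identityˡ x)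

^-distribʳ-* : ∀ x y n → (x * y) ^ n ≡ x ^ n * y ^ n
^-distribʳ-* x y zero    = refl
^-distribʳ-* x y (suc n) = trans (cong (x * y *_) (^-distribʳ-* x y n)) (*-interchange x y _ _)

∸-split : ∀ {m} p q r {t} → p ℕ.+ q ℕ.+ r ≡ m → t ≤ q → m ∸ (p ℕ.+ t) ≡ r ℕ.+ (q ∸ t)
∸-split p q r {t} refl t≤q = begin
  p ℕ.+ q ℕ.+ r ∸ (p ℕ.+ t)
    ≡⟨ cong (λ k → p ℕ.+ k ℕ.+ r ∸ (p ℕ.+ t)) (sym (ℕP.m+[n∸m]≡n t≤q)) ⟩
  p ℕ.+ (t ℕ.+ (q ∸ t)) ℕ.+ r ∸ (p ℕ.+ t)
    ≡⟨ cong (_∸ (p ℕ.+ t)) (regroup p t (q ∸ t) r) ⟩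
  p ℕ.+ t ℕ.+ (r ℕ.+ (q ∸ t)) ∸ (p ℕ.+ t)
    ≡⟨ ℕP.m+n∸m≡n (p ℕ.+ t) _ ⟩
  r ℕ.+ (q ∸ t) ∎
  where
  open ≡-Reasoning
  regroup : ∀ p t d r → p ℕ.+ (t ℕ.+ d) ℕ.+ r ≡ p ℕ.+ t ℕ.+ (r ℕ.+ d)
  regroup = ℕSolver.solve-∀

m+n+o≡p⇒m+n≤p : ∀ m n {o p} → m ℕ.+ n ℕ.+ o ≡ p → m ℕ.+ n ≤ p
m+n+o≡p⇒m+n≤p m n {o} refl = ℕP.m≤m+n (m ℕ.+ n) o

Hbul-poly : ∀ m i y → i ≤ m → poly m (Hbul m i) y ≡ (-1ℤ + y) ^ (m ∸ i)
Hbul-poly m i y i≤m = begin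
  sumTo m (λ j → sgn (+ j - + i) * binom n (+ j - + i) * y ^ (m ∸ j))
    ≡⟨ sumTo-cong m (λ j _ → xy∙z≈y∙xz (sgn (+ j - + i)) _ _) ⟩
  sumTo m (λ j → binom n (+ j - + i) * (sgn (+ j - + i) * y ^ (m ∸ j)))
    ≡⟨ binomial-window m n i -1ℤ y 1ℤ _ (ℕP.≤-reflexive (ℕP.m+[n∸m]≡n i≤m)) term ⟩
  1ℤ * (-1ℤ + y) ^ n
    ≡⟨ ℤP.*-identityˡ _ ⟩
  (-1ℤ + y) ^ n ∎
  where
  open ≡-Reasoning
  n = m ∸ i
  term : ∀ t → t ≤ n → sgn (+ (i ℕ.+ t) - + i) * y ^ (m ∸ (i ℕ.+ t)) ≡ 1ℤ * (sgn (+ t) * y ^ (n ∸ t))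
  term t _ = trans (cong₂ (λ e k → sgn e * y ^ k) (+[m+n]-+m≡+n i t) (sym (ℕP.∸-+-assoc m i t)))
                   (sym (ℤP.*-identityˡ _))

Fup-poly : ∀ m i y → i ≤ m → poly m (Fup m i) y ≡ y ^ (m ∸ i) * (1ℤ + y) ^ i
Fup-poly m i y i≤m = binomial-window₀ m i 1ℤ y (y ^ (m ∸ i)) (λ j → y ^ (m ∸ j)) i≤m term
  where
  term : ∀ t → t ≤ i → y ^ (m ∸ t) ≡ y ^ (m ∸ i) * (1ℤ ^ t * y ^ (i ∸ t))
  term t t≤i = begin
    y ^ (m ∸ t)                            ≡⟨ cong (y ^_) (∸-split 0 i (m ∸ i) (ℕP.m+[n∸m]≡n i≤m) t≤i) ⟩
    y ^ ((m ∸ i) ℕ.+ (i ∸ t))              ≡⟨ ℤP.^-distribˡ-+-* y (m ∸ i) (i ∸ t) ⟩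
    y ^ (m ∸ i) * y ^ (i ∸ t)              ≡⟨ cong (y ^ (m ∸ i) *_) (sym (1^n*x≡x t (y ^ (i ∸ t)))) ⟩
    y ^ (m ∸ i) * (1ℤ ^ t * y ^ (i ∸ t))   ∎
    where open ≡-Reasoning

Hup-poly : ∀ m i y → i ≤ m → poly m (Hup m i) y ≡ y ^ i * (-1ℤ + y) ^ (m ∸ i)
Hup-poly m i y i≤m = begin
  sumTo m (λ j → sgn (+ j) * binom n (+ j) * y ^ (m ∸ j))
    ≡⟨ sumTo-cong m (λ j _ → xy∙z≈y∙xz (sgn (+ j)) _ _) ⟩
  sumTo m (λ j → binom n (+ j) * (sgn (+ j) * y ^ (m ∸ j)))
    ≡⟨ binomial-window₀ m n -1ℤ y (y ^ i) _ (ℕP.m∸n≤m m i) term ⟩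
  y ^ i * (-1ℤ + y) ^ n ∎
  where
  open ≡-Reasoning
  n = m ∸ i
  term : ∀ t → t ≤ n → sgn (+ t) * y ^ (m ∸ t) ≡ y ^ i * (sgn (+ t) * y ^ (n ∸ t))
  term t t≤n = begin
    sgn (+ t) * y ^ (m ∸ t)             ≡⟨ cong (λ k → sgn (+ t) * y ^ k) (∸-split 0 n i (ℕP.m∸n+n≡m i≤m) t≤n) ⟩
    sgn (+ t) * y ^ (i ℕ.+ (n ∸ t))     ≡⟨ cong (sgn (+ t) *_) (ℤP.^-distribˡ-+-* y i (n ∸ t)) ⟩
    sgn (+ t) * (y ^ i * y ^ (n ∸ t))   ≡⟨ x∙yz≈y∙xz (sgn (+ t)) (y ^ i) (y ^ (n ∸ t)) ⟩
    y ^ i * (sgn (+ t) * y ^ (n ∸ t))   ∎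

Fdown-poly : ∀ m i y → i ≤ m → poly m (Fdown m i) y ≡ (y + 1ℤ) ^ i
Fdown-poly m i y i≤m = begin
  sumTo m (λ j → binom i (+ (m ∸ j)) * y ^ (m ∸ j))
    ≡⟨ sumTo-reverse m _ ⟩
  sumTo m (λ j → binom i (+ (m ∸ (m ∸ j))) * y ^ (m ∸ (m ∸ j)))
    ≡⟨ sumTo-cong m (λ j j≤m → cong (λ k → binom i (+ k) * y ^ k) (ℕP.m∸[m∸n]≡n j≤m)) ⟩
  sumTo m (λ j → binom i (+ j) * y ^ j)
    ≡⟨ binomial-window₀ m i y 1ℤ 1ℤ (y ^_) i≤m term ⟩
  1ℤ * (y + 1ℤ) ^ i
    ≡⟨ ℤP.*-identityˡ _ ⟩
  (y + 1ℤ) ^ i ∎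
  where
  open ≡-Reasoning
  term : ∀ t → t ≤ i → y ^ t ≡ 1ℤ * (y ^ t * 1ℤ ^ (i ∸ t))
  term t _ = sym (trans (ℤP.*-identityˡ _) (trans (cong (y ^ t *_) (ℤP.^-zeroˡ (i ∸ t))) (ℤP.*-identityʳ _)))

Hdown≡𝟙 : ∀ m i j → Hdown m i j ≡ 𝟙 ((m ∸ i) ℕ.≟ j)
Hdown≡𝟙 m i j with (m ∸ i) ℕ.≟ j
... | yes p  = sym (𝟙-yes p ((m ∸ i) ℕ.≟ j))
... | no  ¬p = sym (𝟙-no ¬p ((m ∸ i) ℕ.≟ j))

Hdown-poly : ∀ m i y → i ≤ m → poly m (Hdown m i) y ≡ y ^ i
Hdown-poly m i y i≤m = begin
  sumTo m (λ j → Hdown m i j * y ^ (m ∸ j))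
    ≡⟨ sumTo-cong m (λ j _ → cong (_* y ^ (m ∸ j)) (Hdown≡𝟙 m i j)) ⟩
  sumTo m (λ j → 𝟙 ((m ∸ i) ℕ.≟ j) * y ^ (m ∸ j))
    ≡⟨ sumTo-𝟙 m (m ∸ i) (λ j → y ^ (m ∸ j)) (ℕP.m∸n≤m m i) ⟩
  y ^ (m ∸ (m ∸ i))
    ≡⟨ cong (y ^_) (ℕP.m∸[m∸n]≡n i≤m) ⟩
  y ^ i ∎
  where open ≡-Reasoning

a+b+[m∸a∸b]≡m : ∀ {m} a b → a ℕ.+ b ≤ m → a ℕ.+ b ℕ.+ (m ∸ a ∸ b) ≡ m
a+b+[m∸a∸b]≡m {m} a b a+b≤m = trans (cong (a ℕ.+ b ℕ.+_) (ℕP.∸-+-assoc m a b)) (ℕP.m+[n∸m]≡n a+b≤m)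

h-interval : ∀ m a b y → a ℕ.+ b ≤ m →
  sumTo m (λ l → sgn (+ b) * binom (m ∸ a ∸ b) (+ l - + b) * (sgn (+ l) * y ^ (m ∸ l))) ≡ intervalPoly m a b y
h-interval m a b y a+b≤m = begin
  sumTo m (λ l → sgn (+ b) * binom n (+ l - + b) * (sgn (+ l) * y ^ (m ∸ l)))
    ≡⟨ sumTo-cong m (λ l _ → xy∙z≈y∙xz (sgn (+ b)) (binom n (+ l - + b)) (sgn (+ l) * y ^ (m ∸ l))) ⟩
  sumTo m (λ l → binom n (+ l - + b) * (sgn (+ b) * (sgn (+ l) * y ^ (m ∸ l))))
    ≡⟨ binomial-window m n b -1ℤ y (y ^ a) _ (m+n+o≡p⇒m+n≤p b n b+n+a≡m) term ⟩
  y ^ a * (-1ℤ + y) ^ n ∎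
  where
  open ≡-Reasoning
  n = m ∸ a ∸ b
  b+n+a≡m : b ℕ.+ n ℕ.+ a ≡ m
  b+n+a≡m = trans (ℕP.+-comm (b ℕ.+ n) a) (trans (sym (ℕP.+-assoc a b n)) (a+b+[m∸a∸b]≡m a b a+b≤m))
  term : ∀ t → t ≤ n →
    sgn (+ b) * (sgn (+ (b ℕ.+ t)) * y ^ (m ∸ (b ℕ.+ t))) ≡ y ^ a * (sgn (+ t) * y ^ (n ∸ t))
  term t t≤n = begin
    sgn (+ b) * (sgn (+ (b ℕ.+ t)) * y ^ (m ∸ (b ℕ.+ t)))
      ≡⟨ cong₂ (λ s k → sgn (+ b) * (s * y ^ k)) (sgn-+ b t) (∸-split b n a b+n+a≡m t≤n) ⟩
    sgn (+ b) * (sgn (+ b) * sgn (+ t) * y ^ (a ℕ.+ (n ∸ t)))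
      ≡⟨ cong (sgn (+ b) *_) (ℤP.*-assoc (sgn (+ b)) (sgn (+ t)) _) ⟩
    sgn (+ b) * (sgn (+ b) * (sgn (+ t) * y ^ (a ℕ.+ (n ∸ t))))
      ≡⟨ sgn-cancel b _ ⟩
    sgn (+ t) * y ^ (a ℕ.+ (n ∸ t))
      ≡⟨ cong (sgn (+ t) *_) (ℤP.^-distribˡ-+-* y a (n ∸ t)) ⟩
    sgn (+ t) * (y ^ a * y ^ (n ∸ t))
      ≡⟨ x∙yz≈y∙xz (sgn (+ t)) (y ^ a) (y ^ (n ∸ t)) ⟩
    y ^ a * (sgn (+ t) * y ^ (n ∸ t)) ∎

Hbul-interval : ∀ m a b y → a ℕ.+ b ≤ m →
  sumTo m (λ l → binom a (+ l - + b) * (-1ℤ + y) ^ (m ∸ l)) ≡ intervalPoly m a b y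
Hbul-interval m a b y a+b≤m = begin
  sumTo m (λ l → binom a (+ l - + b) * w ^ (m ∸ l))
    ≡⟨ binomial-window m a b 1ℤ w (w ^ n) _ (m+n+o≡p⇒m+n≤p b a b+a+n≡m) term ⟩
  w ^ n * (1ℤ + w) ^ a
    ≡⟨ cong (λ v → w ^ n * v ^ a) (ℤP.suc-pred y) ⟩
  w ^ n * y ^ a
    ≡⟨ ℤP.*-comm (w ^ n) (y ^ a) ⟩
  y ^ a * w ^ n ∎
  where
  open ≡-Reasoning
  n = m ∸ a ∸ b
  w = -1ℤ + y
  b+a+n≡m : b ℕ.+ a ℕ.+ n ≡ m
  b+a+n≡m = trans (cong (ℕ._+ n) (ℕP.+-comm b a)) (a+b+[m∸a∸b]≡m a b a+b≤m)
  term : ∀ t → t ≤ a → w ^ (m ∸ (b ℕ.+ t)) ≡ w ^ n * (1ℤ ^ t * w ^ (a ∸ t))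
  term t t≤a = begin
    w ^ (m ∸ (b ℕ.+ t))              ≡⟨ cong (w ^_) (∸-split b a n b+a+n≡m t≤a) ⟩
    w ^ (n ℕ.+ (a ∸ t))              ≡⟨ ℤP.^-distribˡ-+-* w n (a ∸ t) ⟩
    w ^ n * w ^ (a ∸ t)              ≡⟨ cong (w ^ n *_) (sym (1^n*x≡x t (w ^ (a ∸ t)))) ⟩
    w ^ n * (1ℤ ^ t * w ^ (a ∸ t))   ∎

Hup-interval : ∀ m a b y → a ℕ.+ b ≤ m →
  sumTo m (λ l → sgn (+ (a ℕ.+ b)) * binom b (+ l - + a) * (sgn (+ l) * (y ^ l * (-1ℤ + y) ^ (m ∸ l))))
    ≡ intervalPoly m a b y
Hup-interval m a b y a+b≤m = begin
  sumTo m (λ l → sgn (+ (a ℕ.+ b)) * binom b (+ l - + a) * (sgn (+ l) * (y ^ l * w ^ (m ∸ l))))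
    ≡⟨ sumTo-cong m (λ l _ → xy∙z≈y∙xz (sgn (+ (a ℕ.+ b))) (binom b (+ l - + a)) _) ⟩
  sumTo m (λ l → binom b (+ l - + a) * (sgn (+ (a ℕ.+ b)) * (sgn (+ l) * (y ^ l * w ^ (m ∸ l)))))
    ≡⟨ binomial-window m b a (-1ℤ * y) w (sgn (+ b) * P) _ a+b≤m term ⟩
  sgn (+ b) * P * (-1ℤ * y + w) ^ b
    ≡⟨ cong (λ v → sgn (+ b) * P * v ^ b) (-y+[-1+y]≡-1 y) ⟩
  sgn (+ b) * P * sgn (+ b)
    ≡⟨ trans (ℤP.*-comm (sgn (+ b) * P) (sgn (+ b))) (sgn-cancel b P) ⟩
  P ∎
  where
  open ≡-Reasoning
  n = m ∸ a ∸ b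
  w = -1ℤ + y
  P = y ^ a * w ^ n
  -y+[-1+y]≡-1 : ∀ y → -1ℤ * y + (-1ℤ + y) ≡ -1ℤ
  -y+[-1+y]≡-1 = solve-∀
  regroup : ∀ sa sb st ya yt wn wb →
    sa * sb * (sa * st * (ya * yt * (wn * wb))) ≡ sa * (sa * (sb * (ya * wn) * (st * yt * wb)))
  regroup = solve-∀
  term : ∀ t → t ≤ b → sgn (+ (a ℕ.+ b)) * (sgn (+ (a ℕ.+ t)) * (y ^ (a ℕ.+ t) * w ^ (m ∸ (a ℕ.+ t))))
                       ≡ sgn (+ b) * P * ((-1ℤ * y) ^ t * w ^ (b ∸ t))
  term t t≤b = begin
    sgn (+ (a ℕ.+ b)) * (sgn (+ (a ℕ.+ t)) * (y ^ (a ℕ.+ t) * w ^ (m ∸ (a ℕ.+ t))))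
      ≡⟨ cong₂ _*_ (sgn-+ a b) (cong₂ _*_ (sgn-+ a t) (cong₂ _*_ (ℤP.^-distribˡ-+-* y a t) w-split)) ⟩
    sgn (+ a) * sgn (+ b) * (sgn (+ a) * sgn (+ t) * (y ^ a * y ^ t * (w ^ n * w ^ (b ∸ t))))
      ≡⟨ regroup (sgn (+ a)) (sgn (+ b)) (sgn (+ t)) (y ^ a) (y ^ t) (w ^ n) (w ^ (b ∸ t)) ⟩
    sgn (+ a) * (sgn (+ a) * (sgn (+ b) * P * (sgn (+ t) * y ^ t * w ^ (b ∸ t))))
      ≡⟨ sgn-cancel a _ ⟩
    sgn (+ b) * P * (sgn (+ t) * y ^ t * w ^ (b ∸ t))
      ≡⟨ cong (λ v → sgn (+ b) * P * (v * w ^ (b ∸ t))) (sym (^-distribʳ-* -1ℤ y t)) ⟩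
    sgn (+ b) * P * ((-1ℤ * y) ^ t * w ^ (b ∸ t)) ∎
    where
    w-split : w ^ (m ∸ (a ℕ.+ t)) ≡ w ^ n * w ^ (b ∸ t)
    w-split = trans (cong (w ^_) (∸-split a b n (a+b+[m∸a∸b]≡m a b a+b≤m) t≤b)) (ℤP.^-distribˡ-+-* w n (b ∸ t))

Hdown-interval : ∀ m a b y → a ℕ.+ b ≤ m →
  sumTo m (λ l → sgn (+ b) * binom (m ∸ a ∸ b) (+ l - + a) * (sgn (+ (m ∸ l)) * y ^ l)) ≡ intervalPoly m a b y
Hdown-interval m a b y a+b≤m = begin
  sumTo m (λ l → sgn (+ b) * binom n (+ l - + a) * (sgn (+ (m ∸ l)) * y ^ l))
    ≡⟨ sumTo-cong m (λ l _ → xy∙z≈y∙xz (sgn (+ b)) (binom n (+ l - + a)) (sgn (+ (m ∸ l)) * y ^ l)) ⟩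
  sumTo m (λ l → binom n (+ l - + a) * (sgn (+ b) * (sgn (+ (m ∸ l)) * y ^ l)))
    ≡⟨ binomial-window m n a y -1ℤ (y ^ a) _ (m+n+o≡p⇒m+n≤p a n a+n+b≡m) term ⟩
  y ^ a * (y + -1ℤ) ^ n
    ≡⟨ cong (λ v → y ^ a * v ^ n) (ℤP.+-comm y -1ℤ) ⟩
  y ^ a * (-1ℤ + y) ^ n ∎
  where
  open ≡-Reasoning
  n = m ∸ a ∸ b
  a+n+b≡m : a ℕ.+ n ℕ.+ b ≡ m
  a+n+b≡m = trans (ℕP.+-assoc a n b)
              (trans (cong (a ℕ.+_) (ℕP.+-comm n b)) (trans (sym (ℕP.+-assoc a b n)) (a+b+[m∸a∸b]≡m a b a+b≤m)))
  term : ∀ t → t ≤ n →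
    sgn (+ b) * (sgn (+ (m ∸ (a ℕ.+ t))) * y ^ (a ℕ.+ t)) ≡ y ^ a * (y ^ t * sgn (+ (n ∸ t)))
  term t t≤n = begin
    sgn (+ b) * (sgn (+ (m ∸ (a ℕ.+ t))) * y ^ (a ℕ.+ t))
      ≡⟨ cong (λ k → sgn (+ b) * (sgn (+ k) * y ^ (a ℕ.+ t))) (∸-split a n b a+n+b≡m t≤n) ⟩
    sgn (+ b) * (sgn (+ (b ℕ.+ (n ∸ t))) * y ^ (a ℕ.+ t))
      ≡⟨ cong (λ s → sgn (+ b) * (s * y ^ (a ℕ.+ t))) (sgn-+ b (n ∸ t)) ⟩
    sgn (+ b) * (sgn (+ b) * sgn (+ (n ∸ t)) * y ^ (a ℕ.+ t))
      ≡⟨ trans (cong (sgn (+ b) *_) (ℤP.*-assoc (sgn (+ b)) _ _)) (sgn-cancel b _) ⟩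
    sgn (+ (n ∸ t)) * y ^ (a ℕ.+ t)
      ≡⟨ cong (sgn (+ (n ∸ t)) *_) (ℤP.^-distribˡ-+-* y a t) ⟩
    sgn (+ (n ∸ t)) * (y ^ a * y ^ t)
      ≡⟨ x∙yz≈y∙zx (sgn (+ (n ∸ t))) (y ^ a) (y ^ t) ⟩
    y ^ a * (y ^ t * sgn (+ (n ∸ t))) ∎

Fup-inversion : ∀ m s y → s ≤ m →
  sumTo m (λ l → binom s (+ l) * (sgn (+ l) * (y ^ (m ∸ l) * (1ℤ + y) ^ l))) ≡ sgn (+ s) * y ^ (m ∸ s)
Fup-inversion m s y s≤m = begin
  sumTo m (λ l → binom s (+ l) * (sgn (+ l) * (y ^ (m ∸ l) * (1ℤ + y) ^ l)))
    ≡⟨ binomial-window₀ m s (-1ℤ * (1ℤ + y)) y (y ^ (m ∸ s)) _ s≤m term ⟩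
  y ^ (m ∸ s) * (-1ℤ * (1ℤ + y) + y) ^ s
    ≡⟨ cong (λ v → y ^ (m ∸ s) * v ^ s) (-[1+y]+y≡-1 y) ⟩
  y ^ (m ∸ s) * sgn (+ s)
    ≡⟨ ℤP.*-comm (y ^ (m ∸ s)) (sgn (+ s)) ⟩
  sgn (+ s) * y ^ (m ∸ s) ∎
  where
  open ≡-Reasoning
  -[1+y]+y≡-1 : ∀ y → -1ℤ * (1ℤ + y) + y ≡ -1ℤ
  -[1+y]+y≡-1 = solve-∀
  regroup : ∀ st p q u → st * (p * q * u) ≡ p * (st * u * q)
  regroup = solve-∀
  term : ∀ t → t ≤ s →
    sgn (+ t) * (y ^ (m ∸ t) * (1ℤ + y) ^ t) ≡ y ^ (m ∸ s) * ((-1ℤ * (1ℤ + y)) ^ t * y ^ (s ∸ t))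
  term t t≤s = begin
    sgn (+ t) * (y ^ (m ∸ t) * (1ℤ + y) ^ t)
      ≡⟨ cong (λ k → sgn (+ t) * (y ^ k * (1ℤ + y) ^ t)) (∸-split 0 s (m ∸ s) (ℕP.m+[n∸m]≡n s≤m) t≤s) ⟩
    sgn (+ t) * (y ^ ((m ∸ s) ℕ.+ (s ∸ t)) * (1ℤ + y) ^ t)
      ≡⟨ cong (λ v → sgn (+ t) * (v * (1ℤ + y) ^ t)) (ℤP.^-distribˡ-+-* y (m ∸ s) (s ∸ t)) ⟩
    sgn (+ t) * (y ^ (m ∸ s) * y ^ (s ∸ t) * (1ℤ + y) ^ t)
      ≡⟨ regroup (sgn (+ t)) (y ^ (m ∸ s)) (y ^ (s ∸ t)) ((1ℤ + y) ^ t) ⟩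
    y ^ (m ∸ s) * (sgn (+ t) * (1ℤ + y) ^ t * y ^ (s ∸ t))
      ≡⟨ cong (λ v → y ^ (m ∸ s) * (v * y ^ (s ∸ t))) (sym (^-distribʳ-* -1ℤ (1ℤ + y) t)) ⟩
    y ^ (m ∸ s) * ((-1ℤ * (1ℤ + y)) ^ t * y ^ (s ∸ t)) ∎

Fdown-inversion : ∀ m s y → s ≤ m →
  sumTo m (λ l → binom (m ∸ s) (+ l) * (sgn (+ (m ∸ l)) * (y + 1ℤ) ^ l)) ≡ sgn (+ s) * y ^ (m ∸ s)
Fdown-inversion m s y s≤m = begin
  sumTo m (λ l → binom n (+ l) * (sgn (+ (m ∸ l)) * (y + 1ℤ) ^ l))
    ≡⟨ binomial-window₀ m n (y + 1ℤ) -1ℤ (sgn (+ s)) _ (ℕP.m∸n≤m m s) term ⟩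
  sgn (+ s) * (y + 1ℤ + -1ℤ) ^ n
    ≡⟨ cong (λ v → sgn (+ s) * v ^ n) (trans (ℤP.+-assoc y 1ℤ -1ℤ) (ℤP.+-identityʳ y)) ⟩
  sgn (+ s) * y ^ n ∎
  where
  open ≡-Reasoning
  n = m ∸ s
  term : ∀ t → t ≤ n → sgn (+ (m ∸ t)) * (y + 1ℤ) ^ t ≡ sgn (+ s) * ((y + 1ℤ) ^ t * sgn (+ (n ∸ t)))
  term t t≤n = begin
    sgn (+ (m ∸ t)) * (y + 1ℤ) ^ t
      ≡⟨ cong (λ k → sgn (+ k) * (y + 1ℤ) ^ t) (∸-split 0 n s (ℕP.m∸n+n≡m s≤m) t≤n) ⟩
    sgn (+ (s ℕ.+ (n ∸ t))) * (y + 1ℤ) ^ t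
      ≡⟨ cong (_* (y + 1ℤ) ^ t) (sgn-+ s (n ∸ t)) ⟩
    sgn (+ s) * sgn (+ (n ∸ t)) * (y + 1ℤ) ^ t
      ≡⟨ xy∙z≈x∙zy (sgn (+ s)) (sgn (+ (n ∸ t))) ((y + 1ℤ) ^ t) ⟩
    sgn (+ s) * ((y + 1ℤ) ^ t * sgn (+ (n ∸ t))) ∎

sumTo-sumP : ∀ {m} (Is : Intervals m) (G : ℕ → ℕ → ℕ → ℤ) (d : ℕ → ℤ) →
  sumTo m (λ l → sumP Is (G l) * d l) ≡ sumOver Is (λ I → sumTo m (λ l → G l (gap I) (base I) * d l))
sumTo-sumP {m} Is G d = begin
  sumTo m (λ l → sumP Is (G l) * d l)
    ≡⟨ sumTo-cong m (λ l _ → trans (cong (_* d l) (sumP≡sumOver Is (G l))) (sym (sumOver-*ʳ Is (d l) _))) ⟩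
  sumTo m (λ l → sumOver Is (λ I → G l (gap I) (base I) * d l))
    ≡⟨ sym (sumOver-sumTo Is m _) ⟩
  sumOver Is (λ I → sumTo m (λ l → G l (gap I) (base I) * d l)) ∎
  where open ≡-Reasoning

module IntervalExpansion {m} {Is : Intervals m} (Is⊆ : All (λ I → proj₁ I ⊆ proj₂ I) Is)
  {h : ℕ → ℤ} (h-poly : ∀ y → poly m h y ≡ sumOver Is (λ I → intervalPoly m (gap I) (base I) y)) where

  sumTo-sumP≡h-poly : ∀ (G : ℕ → ℕ → ℕ → ℤ) (d : ℕ → ℤ → ℤ) →
    (∀ i j y → i ℕ.+ j ≤ m → sumTo m (λ l → G l i j * d l y) ≡ intervalPoly m i j y) →
    ∀ y → sumTo m (λ l → sumP Is (G l) * d l y) ≡ poly m h y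
  sumTo-sumP≡h-poly G d G-interval y = begin
    sumTo m (λ l → sumP Is (G l) * d l y)
      ≡⟨ sumTo-sumP Is G (λ l → d l y) ⟩
    sumOver Is (λ I → sumTo m (λ l → G l (gap I) (base I) * d l y))
      ≡⟨ sumOver-cong-All Is⊆ (λ {I} A⊆B → G-interval (gap I) (base I) y (gap+base≤m I A⊆B)) ⟩
    sumOver Is (λ I → intervalPoly m (gap I) (base I) y)
      ≡⟨ sym (h-poly y) ⟩
    poly m h y ∎
    where open ≡-Reasoning

  sumTo-signed-sumP≡h-poly : ∀ (c : ℕ → ℤ) (G : ℕ → ℕ → ℕ → ℤ) (d : ℕ → ℤ → ℤ) →
    (∀ i j y → i ℕ.+ j ≤ m → sumTo m (λ l → G l i j * (c l * d l y)) ≡ intervalPoly m i j y) →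
    ∀ y → sumTo m (λ l → c l * sumP Is (G l) * d l y) ≡ poly m h y
  sumTo-signed-sumP≡h-poly c G d G-interval y =
    trans (sumTo-cong m (λ l _ → xy∙z≈y∙xz (c l) (sumP Is (G l)) (d l y)))
          (sumTo-sumP≡h-poly G (λ l y → c l * d l y) G-interval y)

  h≡signed-sumP : ∀ (c : ℕ → ℤ) (G : ℕ → ℕ → ℕ → ℤ) →
    (∀ i j y → i ℕ.+ j ≤ m → sumTo m (λ l → G l i j * (c l * y ^ (m ∸ l))) ≡ intervalPoly m i j y) →
    ∀ l → l ≤ m → h l ≡ c l * sumP Is (G l)
  h≡signed-sumP c G G-interval = poly-coeffs-unique m h (λ l → c l * sumP Is (G l))
    (λ y → sym (sumTo-signed-sumP≡h-poly c G (λ l y → y ^ (m ∸ l)) G-interval y))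

  isCoords-sumP : ∀ b (e : ℕ → ℤ → ℤ) (G : ℕ → ℕ → ℕ → ℤ) →
    (∀ i y → i ≤ m → poly m (b i) y ≡ e i y) →
    (∀ i j y → i ℕ.+ j ≤ m → sumTo m (λ l → G l i j * e l y) ≡ intervalPoly m i j y) →
    IsCoords m b (λ l → sumP Is (G l)) h
  isCoords-sumP b e G b-poly G-interval =
    isCoords-fromPoly m b (λ l → sumP Is (G l)) h e b-poly (sumTo-sumP≡h-poly G e G-interval)

  isCoords-signed-sumP : ∀ b (e : ℕ → ℤ → ℤ) (c : ℕ → ℤ) (G : ℕ → ℕ → ℕ → ℤ) →
    (∀ i y → i ≤ m → poly m (b i) y ≡ e i y) →
    (∀ i j y → i ℕ.+ j ≤ m → sumTo m (λ l → G l i j * (c l * e l y)) ≡ intervalPoly m i j y) →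
    IsCoords m b (λ l → c l * sumP Is (G l)) h
  isCoords-signed-sumP b e c G b-poly G-interval =
    isCoords-fromPoly m b (λ l → c l * sumP Is (G l)) h e b-poly (sumTo-signed-sumP≡h-poly c G e G-interval)

sumTo-sumTo-reindex : ∀ m n (c d : ℕ → ℤ) (B : ℕ → ℕ → ℤ) (v : ℕ → ℤ) →
  sumTo m (λ l → c l * sumTo n (λ s → B s l * v s) * d l)
    ≡ sumTo n (λ s → sumTo m (λ l → B s l * (c l * d l)) * v s)
sumTo-sumTo-reindex m n c d B v = begin
  sumTo m (λ l → c l * sumTo n (λ s → B s l * v s) * d l)
    ≡⟨ sumTo-cong m (λ l _ → trans (cong (_* d l) (sym (sumTo-*ˡ n (c l) _))) (sym (sumTo-*ʳ n (d l) _))) ⟩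
  sumTo m (λ l → sumTo n (λ s → c l * (B s l * v s) * d l))
    ≡⟨ sumTo-cong m (λ l _ → sumTo-cong n (λ s _ → regroup (c l) (B s l) (v s) (d l))) ⟩
  sumTo m (λ l → sumTo n (λ s → B s l * (c l * d l) * v s))
    ≡⟨ sumTo-comm m n _ ⟩
  sumTo n (λ s → sumTo m (λ l → B s l * (c l * d l) * v s))
    ≡⟨ sumTo-cong n (λ s _ → sumTo-*ʳ m (v s) _) ⟩
  sumTo n (λ s → sumTo m (λ l → B s l * (c l * d l)) * v s) ∎
  where
  open ≡-Reasoning
  regroup : ∀ c b v d → c * (b * v) * d ≡ b * (c * d) * v
  regroup = solve-∀

isCoords-viaInversion : ∀ m b (e : ℕ → ℤ → ℤ) (c : ℕ → ℤ) (B : ℕ → ℕ → ℤ) (v h : ℕ → ℤ) →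
  (∀ i y → i ≤ m → poly m (b i) y ≡ e i y) →
  (∀ s y → s ≤ m → sumTo m (λ l → B s l * (c l * e l y)) ≡ sgn (+ s) * y ^ (m ∸ s)) →
  (∀ s → s ≤ m → h s ≡ sgn (+ s) * v s) →
  IsCoords m b (λ l → c l * sumTo m (λ s → B s l * v s)) h
isCoords-viaInversion m b e c B v h b-poly inversion h≡ =
  isCoords-fromPoly m b (λ l → c l * sumTo m (λ s → B s l * v s)) h e b-poly λ y → begin
  sumTo m (λ l → c l * sumTo m (λ s → B s l * v s) * e l y)
    ≡⟨ sumTo-sumTo-reindex m m c (λ l → e l y) B v ⟩
  sumTo m (λ s → sumTo m (λ l → B s l * (c l * e l y)) * v s)
    ≡⟨ sumTo-cong m (λ s s≤m → cong (_* v s) (inversion s y s≤m)) ⟩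
  sumTo m (λ s → sgn (+ s) * y ^ (m ∸ s) * v s)
    ≡⟨ sumTo-cong m (λ s s≤m → trans (xy∙z≈xz∙y (sgn (+ s)) (y ^ (m ∸ s)) (v s))
                                     (cong (_* y ^ (m ∸ s)) (sym (h≡ s s≤m)))) ⟩
  poly m h y ∎
  where open ≡-Reasoning

mainTheorem8 : (m : ℕ) → 0 < m → (Φ : FaceSystem m) → Unique Φ → 0 < length Φ →
    (Is : Intervals m) → IsIntervalPartition Φ Is →
    (h : ℕ → ℤ) → IsHVector Φ h →
      ((l : ℕ) → l ≤ m →
        h l ≡ sgn (+ l) * sumP Is (λ i j → sgn (+ j) * binom (m ∸ i ∸ j) (+ l - + j)))
    × IsCoords m (Hbul m) (λ l → sumP Is (λ i j → binom i (+ l - + j))) h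
    × IsCoords m (Fup m) (λ l → sgn (+ l) * sumTo m (λ s → binom s (+ l) * innerS Is s)) h
    × IsCoords m (Hup m) (λ l → sgn (+ l) * sumP Is (λ i j → sgn (+ (i Data.Nat.+ j)) * binom j (+ l - + i))) h
    × IsCoords m (Fdown m) (λ l → sgn (+ (m ∸ l)) * sumTo m (λ s → binom (m ∸ s) (+ l) * innerS Is s)) h
    × IsCoords m (Hdown m) (λ l → sgn (+ (m ∸ l)) * sumP Is (λ i j → sgn (+ j) * binom (m ∸ i ∸ j) (+ l - + i))) h
mainTheorem8 m _ Φ Φ! _ Is partition h h-vector =
  h≡ , Hbul-coords , Fup-coords , Hup-coords , Fdown-coords , Hdown-coords
  where
  open IntervalExpansion (proj₁ partition) {h} (λ y → trans (h-vector y) (fPoly≡sumOver-intervalPoly Φ! partition y))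
  h≡ = h≡signed-sumP (λ l → sgn (+ l)) (λ l i j → sgn (+ j) * binom (m ∸ i ∸ j) (+ l - + j)) (h-interval m)
  Hbul-coords = isCoords-sumP (Hbul m) (λ i y → (-1ℤ + y) ^ (m ∸ i)) (λ l i j → binom i (+ l - + j))
                  (Hbul-poly m) (Hbul-interval m)
  Fup-coords = isCoords-viaInversion m (Fup m) (λ i y → y ^ (m ∸ i) * (1ℤ + y) ^ i) (λ l → sgn (+ l))
                 (λ s l → binom s (+ l)) (innerS Is) h (Fup-poly m) (Fup-inversion m) h≡
  Hup-coords = isCoords-signed-sumP (Hup m) (λ i y → y ^ i * (-1ℤ + y) ^ (m ∸ i)) (λ l → sgn (+ l))
                 (λ l i j → sgn (+ (i ℕ.+ j)) * binom j (+ l - + i)) (Hup-poly m) (Hup-interval m)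
  Fdown-coords = isCoords-viaInversion m (Fdown m) (λ i y → (y + 1ℤ) ^ i) (λ l → sgn (+ (m ∸ l)))
                   (λ s l → binom (m ∸ s) (+ l)) (innerS Is) h (Fdown-poly m) (Fdown-inversion m) h≡
  Hdown-coords = isCoords-signed-sumP (Hdown m) (λ i y → y ^ i) (λ l → sgn (+ (m ∸ l)))
                   (λ l i j → sgn (+ j) * binom (m ∸ i ∸ j) (+ l - + i)) (Hdown-poly m) (Hdown-interval m)
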